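{- Let $\psi$ and $\chi$ be MSO formulae over the signature $\{=\}\cup R_2$ with binary relation symbols $R_2$, such that $\psi$ is cw-non-trivial under the restriction $\chi$ and $(\psi,\chi)$ is cw-size-independent. Then there exist $k\in\mathbb N$ and six clique-decompositions $\Gamma=\{\mathcal C_{s_+},\mathcal C_{r_+},\mathcal C_{e_+},\mathcal C_{s_- },\mathcal C_{r_- },\mathcal C_{e_- }\}$ of width at most $k$, with $\mathcal C_{s_+},\mathcal C_{r_+},\mathcal C_{s_- },\mathcal C_{r_- }$ marked, such that for all $\ell\in\mathbb N$: $\Delta^\Gamma(s_+r_+^\ell e_+)\models\psi\wedge\chi$; $\Delta^\Gamma(s_-r_-^\ell e_-)\models\neg\psi\wedge\chi$; and $|\Delta^\Gamma(s_+r_+^\ell e_+)|=|\Delta^\Gamma(s_-r_-^\ell e_-)|$. Moreover $\mathcal C_{r_+}$ and $\mathcal C_{r_- }$ are non-empty (have at least one constant node).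
   Context: An $R_2$-graph is $G=(V,E)$ with $E\subseteq R_2\times V\times V$; $|G|$ is its number of vertices. Clique-decompositions over a finite color set $C$ are binary trees of operations: $\mathsf{constant}^{\mathcal R}_c(v)$ (single vertex $v$ of color $c$ with loops $(r,v,v)$, $r\in\mathcal R\subseteq R_2$), $\mathsf{recolor}_f$ ($f:C\to C$ applied to colors), $\mathsf{join}_M$ ($M\subseteq R_2\times\{\mathsf{left},\mathsf{right}\}\times C^2$: disjoint union of $H,H'$ plus, for $u\in V(H),v\in V(H')$ with colors $c_u,c_v$, arc $(r,u,v)$ iff $(r,\mathsf{right},c_u,c_v)\in M$ and $(r,v,u)$ iff $(r,\mathsf{left},c_v,c_u)\in M$). Width = number of colors used by vertices at some node; clique-width of a graph = minimum width of a decomposition constructing it. A decomposition is identified with the graph it constructs. $\psi$ is cw-non-trivial under $\chi$ if for some $k$ there are infinitely many graphs of clique-width $\le k$ satisfying $\psi\wedge\chi$ and infinitely many satisfying $\neg\psi\wedge\chi$. $(\psi,\chi)$ is cw-size-independent if for some $k$ there are infinitely many $n$ such that there are graphs $G,G'$ with $n$ vertices, clique-width $\le k$, $G\models\psi\wedge\chi$, $G'\models\neg\psi\wedge\chi$. A marked decomposition has exactly one placeholder leaf $\square$ (not a vertex); $\mathcal C\triangleright\mathcal C'$ replaces $\square$ in $\mathcal C$ by $\mathcal C'$; for a family $\Gamma=\{\mathcal C_i\}_{i\in I}$ and word $w_1\cdots w_n$, $\Delta^\Gamma(w_1)=\mathcal C_{w_1}$, $\Delta^\Gamma(w_1\cdots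 w_n)=\Delta^\Gamma(w_1\cdots w_{n-1})\triangleright\mathcal C_{w_n}$. -}

module Defs where

open import Data.Nat using (ℕ; zero; suc; _+_; _⊔_; _≤_)
open import Data.Fin using (Fin; zero; suc; splitAt; _≟_)
open import Data.Bool using (Bool; true; false; _∧_; _∨_; not)
open import Data.Sum using (_⊎_; inj₁; inj₂)
open import Data.List using (List; []; _∷_; foldl)
open import Data.Product using (Σ; _×_; _,_; ∃)
open import Relation.Nullary.Decidable using (⌊_⌋)
open import Relation.Binary.PropositionalEquality using (_≡_)

-- The set R₂ of binary relation symbols is Fin ρ.
-- A color set C is Fin c.
-- An R₂-graph on n vertices has vertex set Fin n and arc relation
-- E : Fin ρ → Fin n → Fin n → Bool  ((r,u,v) ∈ E iff E r u v ≡ true).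

-- MSO formulae over {=} ∪ R₂ (de Bruijn indices; i first-order and
-- j set variables in scope).

data Formula (ρ : ℕ) : ℕ → ℕ → Set where
  _≐_  : ∀ {i j} → Fin i → Fin i → Formula ρ i j
  rel  : ∀ {i j} → Fin ρ → Fin i → Fin i → Formula ρ i j
  _∈̇_  : ∀ {i j} → Fin i → Fin j → Formula ρ i j
  ¬̇_   : ∀ {i j} → Formula ρ i j → Formula ρ i j
  _∧̇_  : ∀ {i j} → Formula ρ i j → Formula ρ i j → Formula ρ i j
  _∨̇_  : ∀ {i j} → Formula ρ i j → Formula ρ i j → Formula ρ i j
  ∃₁   : ∀ {i j} → Formula ρ (suc i) j → Formula ρ i j
  ∀₁   : ∀ {i j} → Formula ρ (suc i) j → Formula ρ i j
  ∃₂   : ∀ {i j} → Formula ρ i (suc j) → Formula ρ i j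
  ∀₂   : ∀ {i j} → Formula ρ i (suc j) → Formula ρ i j

Sentence : ℕ → Set
Sentence ρ = Formula ρ 0 0

cons : ∀ {n} {A : Set} → A → (Fin n → A) → Fin (suc n) → A
cons a f zero    = a
cons a f (suc i) = f i

anyFin : ∀ n → (Fin n → Bool) → Bool
anyFin zero    p = false
anyFin (suc n) p = p zero ∨ anyFin n (λ i → p (suc i))

allFin : ∀ n → (Fin n → Bool) → Bool
allFin zero    p = true
allFin (suc n) p = p zero ∧ allFin n (λ i → p (suc i))

anySubset : ∀ n → ((Fin n → Bool) → Bool) → Bool
anySubset zero    p = p (λ ())
anySubset (suc n) p =
  anySubset n (λ X → p (cons false X)) ∨ anySubset n (λ X → p (cons true X))

allSubset : ∀ n → ((Fin n → Bool) → Bool) → Bool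
allSubset zero    p = p (λ ())
allSubset (suc n) p =
  allSubset n (λ X → p (cons false X)) ∧ allSubset n (λ X → p (cons true X))

toℕ𝔹 : Bool → ℕ
toℕ𝔹 true  = 1
toℕ𝔹 false = 0

countFin : ∀ n → (Fin n → Bool) → ℕ
countFin zero    p = 0
countFin (suc n) p = toℕ𝔹 (p zero) + countFin n (λ i → p (suc i))

eval : ∀ {ρ i j} → Formula ρ i j → (n : ℕ) → (Fin ρ → Fin n → Fin n → Bool)
     → (Fin i → Fin n) → (Fin j → Fin n → Bool) → Bool
eval (x ≐ y)     n E σ τ = ⌊ σ x ≟ σ y ⌋
eval (rel r x y) n E σ τ = E r (σ x) (σ y)
eval (x ∈̇ X)     n E σ τ = τ X (σ x)
eval (¬̇ φ)       n E σ τ = not (eval φ n E σ τ)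
eval (φ ∧̇ φ')    n E σ τ = eval φ n E σ τ ∧ eval φ' n E σ τ
eval (φ ∨̇ φ')    n E σ τ = eval φ n E σ τ ∨ eval φ' n E σ τ
eval (∃₁ φ)      n E σ τ = anyFin n (λ v → eval φ n E (cons v σ) τ)
eval (∀₁ φ)      n E σ τ = allFin n (λ v → eval φ n E (cons v σ) τ)
eval (∃₂ φ)      n E σ τ = anySubset n (λ X → eval φ n E σ (cons X τ))
eval (∀₂ φ)      n E σ τ = allSubset n (λ X → eval φ n E σ (cons X τ))

-- Clique-decompositions over the color set Fin c, possibly containing
-- placeholder leaves □.  A decomposition proper has no □ (holes t ≡ 0),
-- a marked decomposition has exactly one (holes t ≡ 1).
-- Vertices are identified positionally (the vertex name v of
-- constant(v) is immaterial: decompositions are taken up to renaming).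

data Side : Set where
  left right : Side

data CD (ρ c : ℕ) : Set where
  □        : CD ρ c
  constant : (Fin ρ → Bool) → Fin c → CD ρ c        -- loops 𝓡, color
  recolor  : (Fin c → Fin c) → CD ρ c → CD ρ c
  join     : (Fin ρ → Side → Fin c → Fin c → Bool)
           → CD ρ c → CD ρ c → CD ρ c

module _ {ρ c : ℕ} where

  holes : CD ρ c → ℕ
  holes □              = 1
  holes (constant _ _) = 0
  holes (recolor _ t)  = holes t
  holes (join _ l r)   = holes l + holes r

  size : CD ρ c → ℕ
  size □              = 0
  size (constant _ _) = 1
  size (recolor _ t)  = size t
  size (join _ l r)   = size l + size r

  color : (t : CD ρ c) → Fin (size t) → Fin c
  color □ ()
  color (constant _ a) _ = a
  color (recolor f t) v  = f (color t v)
  color (join _ l r) v with splitAt (size l) v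
  ... | inj₁ u = color l u
  ... | inj₂ u = color r u

  joinEdge : (M : Fin ρ → Side → Fin c → Fin c → Bool) (l r : CD ρ c)
           → (Fin ρ → Fin (size l) → Fin (size l) → Bool)
           → (Fin ρ → Fin (size r) → Fin (size r) → Bool)
           → Fin ρ → Fin (size l) ⊎ Fin (size r) → Fin (size l) ⊎ Fin (size r) → Bool
  joinEdge M l r El Er a (inj₁ u) (inj₁ v) = El a u v
  joinEdge M l r El Er a (inj₂ u) (inj₂ v) = Er a u v
  joinEdge M l r El Er a (inj₁ u) (inj₂ v) = M a right (color l u) (color r v)
  joinEdge M l r El Er a (inj₂ u) (inj₁ v) = M a left  (color r u) (color l v)

  edge : (t : CD ρ c) → Fin ρ → Fin (size t) → Fin (size t) → Bool
  edge □ a ()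
  edge (constant L _) a zero zero = L a
  edge (recolor _ t) a u v = edge t a u v
  edge (join M l r) a u v =
    joinEdge M l r (edge l) (edge r) a (splitAt (size l) u) (splitAt (size l) v)

  numColors : CD ρ c → ℕ
  numColors t = countFin c (λ d → anyFin (size t) (λ v → ⌊ color t v ≟ d ⌋))

  width : CD ρ c → ℕ
  width □                = 0
  width t@(constant _ _) = numColors t
  width t@(recolor _ s)  = numColors t ⊔ width s
  width t@(join _ l r)   = numColors t ⊔ (width l ⊔ width r)

  _▹_ : CD ρ c → CD ρ c → CD ρ c
  □ ▹ t'              = t'
  constant L a ▹ t'   = constant L a
  recolor f t ▹ t'    = recolor f (t ▹ t')
  join M l r ▹ t'     = join M (l ▹ t') (r ▹ t')

  -- Δ^Γ(w₁ w₂ ⋯ wₙ) for the word given as 𝒞_{w₁} and the list 𝒞_{w₂} ⋯ 𝒞_{wₙ}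
  Δ : CD ρ c → List (CD ρ c) → CD ρ c
  Δ = foldl _▹_

  _⊨_ : CD ρ c → Sentence ρ → Bool
  t ⊨ φ = eval φ (size t) (edge t) (λ ()) (λ ())

-- Graphs of clique-width ≤ k are (up to isomorphism, under which MSO is
-- invariant) exactly the graphs constructed by a decomposition (without □)
-- of width ≤ k.  "Infinitely many graphs" (up to isomorphism; finitely
-- many exist of each size since R₂ is finite) = of unbounded size.

CwInfinitelyMany : ∀ {ρ} → ℕ → Sentence ρ → Set
CwInfinitelyMany {ρ} k φ =
  ∀ N → ∃ λ c → Σ (CD ρ c) λ t →
    holes t ≡ 0 × width t ≤ k × N ≤ size t × (t ⊨ φ) ≡ true

CwNonTrivial : ∀ {ρ} → Sentence ρ → Sentence ρ → Set
CwNonTrivial ψ χ =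
  ∃ λ k → CwInfinitelyMany k (ψ ∧̇ χ) × CwInfinitelyMany k ((¬̇ ψ) ∧̇ χ)

CwGraphOfSize : ∀ {ρ} → ℕ → ℕ → Sentence ρ → Set
CwGraphOfSize {ρ} k n φ =
  ∃ λ c → Σ (CD ρ c) λ t →
    holes t ≡ 0 × width t ≤ k × size t ≡ n × (t ⊨ φ) ≡ true

CwSizeIndependent : ∀ {ρ} → Sentence ρ → Sentence ρ → Set
CwSizeIndependent ψ χ =
  ∃ λ k → ∀ N → ∃ λ n → N ≤ n ×
    CwGraphOfSize k n (ψ ∧̇ χ) × CwGraphOfSize k n ((¬̇ ψ) ∧̇ χ)

-- MSO sentences of quantifier depth q do not distinguish decompositions that
-- are equivalent in the q-round back-and-forth game on set variables, and this
-- equivalence is a congruence for recolor, join and plugging into a marked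
-- decomposition.  Once the colors of a decomposition of width at most k are
-- renamed into Fin k, its equivalence class is one of finitely many types,
-- their number depending on k and q only.  A decomposition with at least 2^B
-- vertices is a chain of B non-empty marked pieces, so two of its B + 1
-- suffixes have the same type, and the part between them can be repeated
-- without changing the truth of the sentence.  Size independence supplies, for
-- every bound, graphs of one common size satisfying ψ ∧ χ and ¬ψ ∧ χ; pumping
-- both and repeating each loop as often as the other loop has vertices makes
-- the two families grow in lockstep.
module Submission where

open import Data.Bool using (Bool; true; false; _∧_; _∨_; not) renaming (_≟_ to _≟ᵇ_)
open import Data.Bool.Properties using (∨-assoc; ∨-zeroʳ; ∧-zeroʳ; not-involutive)
open import Data.Empty using (⊥-elim)
open import Data.Fin using (Fin; zero; suc; toℕ; fromℕ<; splitAt; _↑ˡ_; _↑ʳ_; combine; funToFin; finToFun)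
  renaming (_≟_ to _≟ᶠ_)
open import Data.Fin.Properties
  using (splitAt-↑ˡ; splitAt-↑ʳ; splitAt⁻¹-↑ˡ; splitAt⁻¹-↑ʳ; join-splitAt; combine-injective;
         finToFun-funToFin; toℕ-fromℕ<; toℕ-injective; toℕ<n; pigeonhole; any?)
  renaming (suc-injective to suc-injectiveᶠ)
open import Data.List using (List; []; _∷_; _++_; replicate; length; take; drop)
open import Data.List.Properties using (drop-drop)
open import Data.List.Relation.Unary.All using (All; []; _∷_)
open import Data.List.Relation.Unary.All.Properties using (take⁺; drop⁺)
open import Data.Maybe using (Maybe; just; nothing; maybe)
open import Data.Nat using (ℕ; zero; suc; _+_; _*_; _^_; _⊔_; _≤_; _<_; z≤n; s≤s; z<s; _<?_; _≤?_)
  renaming (_≟_ to _≟ⁿ_)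
open import Data.Nat.Properties
open import Algebra.Properties.CommutativeSemigroup +-commutativeSemigroup
  using () renaming (interchange to +-interchange)
open import Data.Nat.Solver using (module +-*-Solver)
open import Data.Product using (Σ; ∃; _×_; _,_; proj₁; proj₂)
open import Data.Sum using (_⊎_; inj₁; inj₂; [_,_]′)
open import Data.Sum.Properties using ([,]-∘)
open import Defs
open import Function using (_∘_)
open import Relation.Binary.Definitions using (tri<; tri≈; tri>)
open import Relation.Binary.PropositionalEquality
open import Relation.Nullary using (¬_; Dec; yes; no; _×-dec_)
open import Relation.Nullary.Decidable using (⌊_⌋)

open +-*-Solver using (solve; _:+_; _:*_; _:=_; con)

private variable
  m n : ℕ

true⇔⇒≡ : ∀ {a b : Bool} → (a ≡ true → b ≡ true) → (b ≡ true → a ≡ true) → a ≡ b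
true⇔⇒≡ {true}  {true}  f g = refl
true⇔⇒≡ {true}  {false} f g = sym (f refl)
true⇔⇒≡ {false} {true}  f g = g refl
true⇔⇒≡ {false} {false} f g = refl

∨-true⁻ : ∀ {a b} → a ∨ b ≡ true → a ≡ true ⊎ b ≡ true
∨-true⁻ {true}  p = inj₁ refl
∨-true⁻ {false} p = inj₂ p

∨-trueˡ : ∀ {a} b → a ≡ true → a ∨ b ≡ true
∨-trueˡ b refl = refl

∨-trueʳ : ∀ a {b} → b ≡ true → a ∨ b ≡ true
∨-trueʳ true  p = refl
∨-trueʳ false p = p

∧-true⁻ˡ : ∀ a {b} → a ∧ b ≡ true → a ≡ true
∧-true⁻ˡ true p = refl

∧-true⁻ʳ : ∀ a {b} → a ∧ b ≡ true → b ≡ true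
∧-true⁻ʳ true p = p

∧-true : ∀ {a b} → a ≡ true → b ≡ true → a ∧ b ≡ true
∧-true refl refl = refl

∨-as-∧ : ∀ a b → a ∨ b ≡ not (not a ∧ not b)
∨-as-∧ true  b     = refl
∨-as-∧ false true  = refl
∨-as-∧ false false = refl

∧-cong₃ : ∀ {a a' b b' e e' : Bool} → a ≡ a' → b ≡ b' → e ≡ e' → a ∧ (b ∧ e) ≡ a' ∧ (b' ∧ e')
∧-cong₃ refl refl refl = refl

module _ {p} {P : Set p} where

  ⌊⌋-sound : {P? : Dec P} → ⌊ P? ⌋ ≡ true → P
  ⌊⌋-sound {yes x} _ = x

  ⌊⌋-complete : (P? : Dec P) → P → ⌊ P? ⌋ ≡ true
  ⌊⌋-complete (yes _) _  = refl
  ⌊⌋-complete (no ¬x) x = ⊥-elim (¬x x)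

  ⌊⌋-false : (P? : Dec P) → ¬ P → ⌊ P? ⌋ ≡ false
  ⌊⌋-false (yes x) ¬x = ⊥-elim (¬x x)
  ⌊⌋-false (no _)  _  = refl

⌊≟⌋-refl : (u : Fin n) → ⌊ u ≟ᶠ u ⌋ ≡ true
⌊≟⌋-refl u = ⌊⌋-complete (u ≟ᶠ u) refl

anyFin-true⁻ : ∀ n (p : Fin n → Bool) → anyFin n p ≡ true → ∃ λ i → p i ≡ true
anyFin-true⁻ (suc n) p e with ∨-true⁻ {p zero} e
... | inj₁ p0 = zero , p0
... | inj₂ ps with anyFin-true⁻ n (λ i → p (suc i)) ps
...   | i , pi = suc i , pi

anyFin-true : ∀ n (p : Fin n → Bool) i → p i ≡ true → anyFin n p ≡ true
anyFin-true (suc n) p zero    e = ∨-trueˡ _ e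
anyFin-true (suc n) p (suc i) e = ∨-trueʳ (p zero) (anyFin-true n (λ i → p (suc i)) i e)

anyFin-false : ∀ n (p : Fin n → Bool) → (∀ i → p i ≡ false) → anyFin n p ≡ false
anyFin-false zero    p h = refl
anyFin-false (suc n) p h rewrite h zero = anyFin-false n _ (λ i → h (suc i))

allFin-true⁻ : ∀ n (p : Fin n → Bool) → allFin n p ≡ true → ∀ i → p i ≡ true
allFin-true⁻ (suc n) p e zero    = ∧-true⁻ˡ _ e
allFin-true⁻ (suc n) p e (suc i) = allFin-true⁻ n (λ i → p (suc i)) (∧-true⁻ʳ (p zero) e) i

allFin-true : ∀ n (p : Fin n → Bool) → (∀ i → p i ≡ true) → allFin n p ≡ true
allFin-true zero    p f = refl
allFin-true (suc n) p f = ∧-true (f zero) (allFin-true n (λ i → p (suc i)) (λ i → f (suc i)))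

allFin≡not-anyFin-not : ∀ n (p : Fin n → Bool) → allFin n p ≡ not (anyFin n (λ i → not (p i)))
allFin≡not-anyFin-not zero    p = refl
allFin≡not-anyFin-not (suc n) p with p zero
... | true  = allFin≡not-anyFin-not n _
... | false = refl

anyFin-cong : ∀ n {p q : Fin n → Bool} → p ≗ q → anyFin n p ≡ anyFin n q
anyFin-cong zero    f = refl
anyFin-cong (suc n) f = cong₂ _∨_ (f zero) (anyFin-cong n (λ i → f (suc i)))

allFin-cong : ∀ n {p q : Fin n → Bool} → p ≗ q → allFin n p ≡ allFin n q
allFin-cong zero    f = refl
allFin-cong (suc n) f = cong₂ _∧_ (f zero) (allFin-cong n (λ i → f (suc i)))

anyFin-∨ : ∀ n (p q : Fin n → Bool) → anyFin n (λ i → p i ∨ q i) ≡ anyFin n p ∨ anyFin n q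
anyFin-∨ zero    p q = refl
anyFin-∨ (suc n) p q rewrite anyFin-∨ n (λ i → p (suc i)) (λ i → q (suc i)) with p zero | q zero
... | true  | _     = refl
... | false | true  = sym (∨-zeroʳ (anyFin n (λ i → p (suc i))))
... | false | false = refl

anyFin-+ : ∀ m n (p : Fin (m + n) → Bool) →
  anyFin (m + n) p ≡ anyFin m (λ i → p (i ↑ˡ n)) ∨ anyFin n (λ i → p (m ↑ʳ i))
anyFin-+ zero    n p = refl
anyFin-+ (suc m) n p =
  trans (cong (p zero ∨_) (anyFin-+ m n (λ i → p (suc i)))) (sym (∨-assoc (p zero) _ _))

allFin-+ : ∀ m n (p : Fin (m + n) → Bool) →
  allFin (m + n) p ≡ allFin m (λ i → p (i ↑ˡ n)) ∧ allFin n (λ i → p (m ↑ʳ i))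
allFin-+ zero    n p = refl
allFin-+ (suc m) n p with p zero
... | true  = allFin-+ m n (λ i → p (suc i))
... | false = refl

countFin-cong : ∀ n {p q : Fin n → Bool} → p ≗ q → countFin n p ≡ countFin n q
countFin-cong zero    f = refl
countFin-cong (suc n) f = cong₂ _+_ (cong toℕ𝔹 (f zero)) (countFin-cong n (λ i → f (suc i)))

countFin-+ : ∀ m n (p : Fin (m + n) → Bool) →
  countFin (m + n) p ≡ countFin m (λ i → p (i ↑ˡ n)) + countFin n (λ i → p (m ↑ʳ i))
countFin-+ zero    n p = refl
countFin-+ (suc m) n p =
  trans (cong (toℕ𝔹 (p zero) +_) (countFin-+ m n (λ i → p (suc i)))) (sym (+-assoc (toℕ𝔹 (p zero)) _ _))

countFin≤ : ∀ n (p : Fin n → Bool) → countFin n p ≤ n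
countFin≤ zero    p = z≤n
countFin≤ (suc n) p with p zero
... | true  = s≤s (countFin≤ n _)
... | false = m≤n⇒m≤1+n (countFin≤ n _)

countFin-false : ∀ n (p : Fin n → Bool) → (∀ i → p i ≡ false) → countFin n p ≡ 0
countFin-false zero    p h = refl
countFin-false (suc n) p h rewrite h zero = countFin-false n _ (λ i → h (suc i))

countFin≡0⁻ : ∀ n (p : Fin n → Bool) → countFin n p ≡ 0 → ∀ i → p i ≡ false
countFin≡0⁻ (suc n) p h i with p zero in eq
countFin≡0⁻ (suc n) p h zero    | false = eq
countFin≡0⁻ (suc n) p h (suc i) | false = countFin≡0⁻ n (λ i → p (suc i)) h i

countFin-mono : ∀ n (p q : Fin n → Bool) → (∀ i → p i ≡ true → q i ≡ true) → countFin n p ≤ countFin n q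
countFin-mono zero    p q h = z≤n
countFin-mono (suc n) p q h with p zero in ep | q zero in eq
... | true  | true  = s≤s (countFin-mono n _ _ (λ i → h (suc i)))
... | true  | false with () ← trans (sym (h zero ep)) eq
... | false | true  = m≤n⇒m≤1+n (countFin-mono n _ _ (λ i → h (suc i)))
... | false | false = countFin-mono n _ _ (λ i → h (suc i))

countFin-strict : ∀ n (p q : Fin n → Bool) → (∀ i → p i ≡ true → q i ≡ true) →
  ∀ j → q j ≡ true → p j ≡ false → countFin n p < countFin n q
countFin-strict (suc n) p q h zero qj pj rewrite qj | pj = s≤s (countFin-mono n _ _ (λ i → h (suc i)))
countFin-strict (suc n) p q h (suc j) qj pj with p zero in ep | q zero in eq
... | true  | true  = s≤s (countFin-strict n _ _ (λ i → h (suc i)) j qj pj)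
... | true  | false with () ← trans (sym (h zero ep)) eq
... | false | true  = m≤n⇒m≤1+n (countFin-strict n _ _ (λ i → h (suc i)) j qj pj)
... | false | false = countFin-strict n _ _ (λ i → h (suc i)) j qj pj

countFin-true : ∀ n → countFin n (λ _ → true) ≡ n
countFin-true zero    = refl
countFin-true (suc n) = cong suc (countFin-true n)

Extensional : ∀ n → ((Fin n → Bool) → Bool) → Set
Extensional n p = ∀ X Y → X ≗ Y → p X ≡ p Y

anySubset-cong : ∀ n {p q : (Fin n → Bool) → Bool} → (∀ X → p X ≡ q X) → anySubset n p ≡ anySubset n q
anySubset-cong zero    f = f _
anySubset-cong (suc n) f = cong₂ _∨_ (anySubset-cong n (λ X → f _)) (anySubset-cong n (λ X → f _))

allSubset-cong : ∀ n {p q : (Fin n → Bool) → Bool} → (∀ X → p X ≡ q X) → allSubset n p ≡ allSubset n q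
allSubset-cong zero    f = f _
allSubset-cong (suc n) f = cong₂ _∧_ (allSubset-cong n (λ X → f _)) (allSubset-cong n (λ X → f _))

anySubset-true⁻ : ∀ n (p : (Fin n → Bool) → Bool) → anySubset n p ≡ true → ∃ λ X → p X ≡ true
anySubset-true⁻ zero    p e = _ , e
anySubset-true⁻ (suc n) p e with ∨-true⁻ {anySubset n (λ X → p (cons false X))} e
... | inj₁ e₀ = let X , pX = anySubset-true⁻ n _ e₀ in cons false X , pX
... | inj₂ e₁ = let X , pX = anySubset-true⁻ n _ e₁ in cons true X , pX

anySubset-true : ∀ n (p : (Fin n → Bool) → Bool) → Extensional n p → ∀ X → p X ≡ true → anySubset n p ≡ true
anySubset-true zero    p ext X e = trans (ext _ X (λ ())) e
anySubset-true (suc n) p ext X e = branch (X zero) refl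
  where
  tail-true : ∀ b → X zero ≡ b → anySubset n (λ Y → p (cons b Y)) ≡ true
  tail-true b eq = anySubset-true n _ (λ A B h → ext _ _ λ { zero → refl ; (suc i) → h i })
    (λ i → X (suc i)) (trans (ext _ X λ { zero → sym eq ; (suc i) → refl }) e)
  branch : ∀ b → X zero ≡ b → anySubset (suc n) p ≡ true
  branch false eq = ∨-trueˡ _ (tail-true false eq)
  branch true  eq = ∨-trueʳ _ (tail-true true eq)

allSubset≡not-anySubset-not : ∀ n (p : (Fin n → Bool) → Bool) →
  allSubset n p ≡ not (anySubset n (λ X → not (p X)))
allSubset≡not-anySubset-not zero    p = sym (not-involutive (p _))
allSubset≡not-anySubset-not (suc n) p
  rewrite allSubset≡not-anySubset-not n (λ X → p (cons false X))
        | allSubset≡not-anySubset-not n (λ X → p (cons true X))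
  with anySubset n (λ X → not (p (cons false X))) | anySubset n (λ X → not (p (cons true X)))
... | true  | _     = refl
... | false | true  = refl
... | false | false = refl

-- MSO as a logic of sets

Val : ℕ → ℕ → Set
Val j n = Fin j → Fin n → Bool

_≋_ : ∀ {j} → Val j n → Val j n → Set
T ≋ U = ∀ X → T X ≗ U X

cons-≋ : ∀ {j} (Y : Fin n → Bool) {T U : Val j n} → T ≋ U → cons Y T ≋ cons Y U
cons-≋ Y h zero    v = refl
cons-≋ Y h (suc X) v = h X v

cons-≗ : ∀ {j} {Y Z : Fin n → Bool} (T : Val j n) → Y ≗ Z → cons Y T ≋ cons Z T
cons-≗ T h zero    v = h v
cons-≗ T h (suc X) v = refl

-- Cardinalities are observed only up to 2, enough to recognise singletons.
cap2 : ℕ → Fin 3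
cap2 zero          = zero
cap2 (suc zero)    = suc zero
cap2 (suc (suc _)) = suc (suc zero)

_+₃_ : Fin 3 → Fin 3 → Fin 3
zero           +₃ b       = b
suc zero       +₃ zero    = suc zero
suc zero       +₃ suc _   = suc (suc zero)
suc (suc zero) +₃ _       = suc (suc zero)

cap2-+ : ∀ a b → cap2 (a + b) ≡ cap2 a +₃ cap2 b
cap2-+ zero                b             = refl
cap2-+ (suc zero)          zero          = refl
cap2-+ (suc zero)          (suc zero)    = refl
cap2-+ (suc zero)          (suc (suc b)) = refl
cap2-+ (suc (suc a))       b             = refl

isOne : Fin 3 → Bool
isOne (suc zero) = true
isOne _          = false

isOne-cap2⁻ : ∀ k → isOne (cap2 k) ≡ true → k ≡ 1
isOne-cap2⁻ (suc zero) h = refl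

module _ {j : ℕ} where

  subsetAt : ∀ n → Val j n → Fin j → Fin j → Bool
  subsetAt n T X Y = allFin n (λ v → not (T X v) ∨ T Y v)

  arcAt : ∀ {ρ} n → (Fin ρ → Fin n → Fin n → Bool) → Val j n → Fin ρ → Fin j → Fin j → Bool
  arcAt n E T a X Y = anyFin n (λ u → anyFin n (λ v → T X u ∧ (T Y v ∧ E a u v)))

  sizeAt : ∀ n → Val j n → Fin j → Fin 3
  sizeAt n T X = cap2 (countFin n (T X))

  subsetAt-cong : ∀ n {T U : Val j n} → T ≋ U → ∀ X Y → subsetAt n T X Y ≡ subsetAt n U X Y
  subsetAt-cong n h X Y = allFin-cong n (λ v → cong₂ (λ a b → not a ∨ b) (h X v) (h Y v))

  arcAt-cong : ∀ {ρ} n E {T U : Val j n} → T ≋ U → ∀ (a : Fin ρ) X Y → arcAt n E T a X Y ≡ arcAt n E U a X Y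
  arcAt-cong n E h a X Y = anyFin-cong n (λ u → anyFin-cong n (λ v → ∧-cong₃ (h X u) (h Y v) refl))

  sizeAt-cong : ∀ n {T U : Val j n} → T ≋ U → ∀ X → sizeAt n T X ≡ sizeAt n U X
  sizeAt-cong n h X = cong cap2 (countFin-cong n (h X))

-- MSO formulas whose variables all range over sets; a first-order
-- variable becomes a set variable constrained to be a singleton.
data SetFormula (ρ : ℕ) : ℕ → Set where
  sub  : ∀ {j} → Fin j → Fin j → SetFormula ρ j
  arc  : ∀ {j} → Fin ρ → Fin j → Fin j → SetFormula ρ j
  sing : ∀ {j} → Fin j → SetFormula ρ j
  neg  : ∀ {j} → SetFormula ρ j → SetFormula ρ j
  and  : ∀ {j} → SetFormula ρ j → SetFormula ρ j → SetFormula ρ j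
  ex   : ∀ {j} → SetFormula ρ (suc j) → SetFormula ρ j

depth : ∀ {ρ j} → SetFormula ρ j → ℕ
depth (sub _ _)   = 0
depth (arc _ _ _) = 0
depth (sing _)    = 0
depth (neg φ)     = depth φ
depth (and φ ψ)   = depth φ ⊔ depth ψ
depth (ex φ)      = suc (depth φ)

evalˢ : ∀ {ρ j} → SetFormula ρ j → (n : ℕ) → (Fin ρ → Fin n → Fin n → Bool) → Val j n → Bool
evalˢ (sub X Y)   n E T = subsetAt n T X Y
evalˢ (arc a X Y) n E T = arcAt n E T a X Y
evalˢ (sing X)    n E T = isOne (sizeAt n T X)
evalˢ (neg φ)     n E T = not (evalˢ φ n E T)
evalˢ (and φ ψ)   n E T = evalˢ φ n E T ∧ evalˢ ψ n E T
evalˢ (ex φ)      n E T = anySubset n (λ Y → evalˢ φ n E (cons Y T))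

evalˢ-cong : ∀ {ρ j} (φ : SetFormula ρ j) n E {T U : Val j n} → T ≋ U → evalˢ φ n E T ≡ evalˢ φ n E U
evalˢ-cong (sub X Y)   n E h = subsetAt-cong n h X Y
evalˢ-cong (arc a X Y) n E h = arcAt-cong n E h a X Y
evalˢ-cong (sing X)    n E h = cong isOne (sizeAt-cong n h X)
evalˢ-cong (neg φ)     n E h = cong not (evalˢ-cong φ n E h)
evalˢ-cong (and φ ψ)   n E h = cong₂ _∧_ (evalˢ-cong φ n E h) (evalˢ-cong ψ n E h)
evalˢ-cong (ex φ)      n E h = anySubset-cong n (λ Y → evalˢ-cong φ n E (cons-≋ Y h))

evalˢ-extensional : ∀ {ρ j} (φ : SetFormula ρ (suc j)) n E (T : Val j n) →
  Extensional n (λ Y → evalˢ φ n E (cons Y T))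
evalˢ-extensional φ n E T X Z h = evalˢ-cong φ n E (cons-≗ T h)

singleton : Fin n → Fin n → Bool
singleton v u = ⌊ u ≟ᶠ v ⌋

⌊suc≟suc⌋ : (i v : Fin n) → ⌊ suc i ≟ᶠ suc v ⌋ ≡ ⌊ i ≟ᶠ v ⌋
⌊suc≟suc⌋ i v = true⇔⇒≡ (λ h → ⌊⌋-complete (i ≟ᶠ v) (suc-injectiveᶠ (⌊⌋-sound h)))
                        (λ h → ⌊⌋-complete (suc i ≟ᶠ suc v) (cong suc (⌊⌋-sound h)))

countFin-singleton : ∀ n (v : Fin n) → countFin n (singleton v) ≡ 1
countFin-singleton (suc n) zero    = cong suc (countFin-false n _ (λ i → refl))
countFin-singleton (suc n) (suc v) =
  trans (countFin-cong n (λ i → ⌊suc≟suc⌋ i v)) (countFin-singleton n v)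

countFin≡1⁻ : ∀ n (Y : Fin n → Bool) → countFin n Y ≡ 1 → ∃ λ v → Y ≗ singleton v
countFin≡1⁻ (suc n) Y h with Y zero in eq
... | true  = zero , λ { zero → eq ; (suc i) → countFin≡0⁻ n (λ i → Y (suc i)) (suc-injective h) i }
... | false with countFin≡1⁻ n (λ i → Y (suc i)) h
...   | v , hv = suc v , λ { zero → eq ; (suc i) → trans (hv i) (sym (⌊suc≟suc⌋ i v)) }

subsetAt-singleton : ∀ n (v : Fin n) (Z : Fin n → Bool) → allFin n (λ u → not (singleton v u) ∨ Z u) ≡ Z v
subsetAt-singleton n v Z = true⇔⇒≡
  (λ h → subst (λ b → not b ∨ Z v ≡ true) (⌊≟⌋-refl v) (allFin-true⁻ n _ h v))
  (λ h → allFin-true n _ (outside-or-in h))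
  where
  outside-or-in : Z v ≡ true → ∀ u → not (singleton v u) ∨ Z u ≡ true
  outside-or-in h u with u ≟ᶠ v
  ... | yes refl = h
  ... | no _     = refl

arcAt-singletons : ∀ {ρ} n (E : Fin ρ → Fin n → Fin n → Bool) a (s t : Fin n) →
  anyFin n (λ u → anyFin n (λ v → singleton s u ∧ (singleton t v ∧ E a u v))) ≡ E a s t
arcAt-singletons n E a s t = true⇔⇒≡ to from
  where
  to : _ ≡ true → E a s t ≡ true
  to h with anyFin-true⁻ n _ h
  ... | u , hu with anyFin-true⁻ n _ hu
  ...   | v , huv =
    let u≡s = ⌊⌋-sound (∧-true⁻ˡ (singleton s u) huv)
        v≡t = ⌊⌋-sound (∧-true⁻ˡ (singleton t v) (∧-true⁻ʳ (singleton s u) huv))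
    in subst₂ (λ x y → E a x y ≡ true) u≡s v≡t (∧-true⁻ʳ (singleton t v) (∧-true⁻ʳ (singleton s u) huv))
  from : E a s t ≡ true → _ ≡ true
  from h = anyFin-true n _ s (anyFin-true n _ t (∧-true (⌊≟⌋-refl s) (∧-true (⌊≟⌋-refl t) h)))

anySubset-singleton : ∀ n (P : (Fin n → Bool) → Bool) → Extensional n P →
  anySubset n (λ Y → isOne (cap2 (countFin n Y)) ∧ P Y) ≡ anyFin n (λ v → P (singleton v))
anySubset-singleton n P ext = true⇔⇒≡ to from
  where
  to : _ ≡ true → _ ≡ true
  to h = let Y , hY = anySubset-true⁻ n _ h
             one = ∧-true⁻ˡ (isOne (cap2 (countFin n Y))) hY
             v , Y≗v = countFin≡1⁻ n Y (isOne-cap2⁻ _ one)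
         in anyFin-true n _ v (trans (sym (ext Y (singleton v) Y≗v)) (∧-true⁻ʳ (isOne (cap2 (countFin n Y))) hY))
  from : _ ≡ true → _ ≡ true
  from h = let v , hv = anyFin-true⁻ n _ h in
    anySubset-true n _ (λ X Z e → cong₂ (λ a b → isOne (cap2 a) ∧ b) (countFin-cong n e) (ext X Z e)) (singleton v)
      (∧-true (cong (λ k → isOne (cap2 k)) (countFin-singleton n v)) hv)

toSet : ∀ {ρ i j k} → Formula ρ i j → (Fin i → Fin k) → (Fin j → Fin k) → SetFormula ρ k
toSet (x ≐ y)     f g = sub (f x) (f y)
toSet (rel a x y) f g = arc a (f x) (f y)
toSet (x ∈̇ X)     f g = sub (f x) (g X)
toSet (¬̇ φ)       f g = neg (toSet φ f g)
toSet (φ ∧̇ ψ)     f g = and (toSet φ f g) (toSet ψ f g)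
toSet (φ ∨̇ ψ)     f g = neg (and (neg (toSet φ f g)) (neg (toSet ψ f g)))
toSet (∃₁ φ)      f g = ex (and (sing zero) (toSet φ (cons zero (suc ∘ f)) (suc ∘ g)))
toSet (∀₁ φ)      f g = neg (ex (and (sing zero) (neg (toSet φ (cons zero (suc ∘ f)) (suc ∘ g)))))
toSet (∃₂ φ)      f g = ex (toSet φ (suc ∘ f) (cons zero (suc ∘ g)))
toSet (∀₂ φ)      f g = neg (ex (neg (toSet φ (suc ∘ f) (cons zero (suc ∘ g)))))

eval≡evalˢ-toSet : ∀ {ρ i j k} (φ : Formula ρ i j) n E (σ : Fin i → Fin n) (τ : Fin j → Fin n → Bool)
  (f : Fin i → Fin k) (g : Fin j → Fin k) (T : Val k n) →
  (∀ x → T (f x) ≗ singleton (σ x)) → (∀ X → T (g X) ≗ τ X) →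
  eval φ n E σ τ ≡ evalˢ (toSet φ f g) n E T
eval≡evalˢ-toSet (x ≐ y) n E σ τ f g T hf hg =
  sym (trans (allFin-cong n (λ v → cong₂ (λ a b → not a ∨ b) (hf x v) (hf y v)))
             (subsetAt-singleton n (σ x) (singleton (σ y))))
eval≡evalˢ-toSet (rel a x y) n E σ τ f g T hf hg =
  sym (trans (anyFin-cong n (λ u → anyFin-cong n (λ v → ∧-cong₃ (hf x u) (hf y v) refl)))
             (arcAt-singletons n E a (σ x) (σ y)))
eval≡evalˢ-toSet (x ∈̇ X) n E σ τ f g T hf hg =
  sym (trans (allFin-cong n (λ v → cong₂ (λ a b → not a ∨ b) (hf x v) (hg X v)))
             (subsetAt-singleton n (σ x) (τ X)))
eval≡evalˢ-toSet (¬̇ φ) n E σ τ f g T hf hg = cong not (eval≡evalˢ-toSet φ n E σ τ f g T hf hg)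
eval≡evalˢ-toSet (φ ∧̇ ψ) n E σ τ f g T hf hg =
  cong₂ _∧_ (eval≡evalˢ-toSet φ n E σ τ f g T hf hg) (eval≡evalˢ-toSet ψ n E σ τ f g T hf hg)
eval≡evalˢ-toSet (φ ∨̇ ψ) n E σ τ f g T hf hg =
  trans (∨-as-∧ (eval φ n E σ τ) (eval ψ n E σ τ))
        (cong₂ (λ a b → not (not a ∧ not b)) (eval≡evalˢ-toSet φ n E σ τ f g T hf hg)
                                             (eval≡evalˢ-toSet ψ n E σ τ f g T hf hg))
eval≡evalˢ-toSet (∃₁ φ) n E σ τ f g T hf hg =
  sym (trans (anySubset-singleton n _ (evalˢ-extensional (toSet φ _ _) n E T))
             (anyFin-cong n (λ v → sym (eval≡evalˢ-toSet φ n E (cons v σ) τ _ _ (cons (singleton v) T)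
               (λ { zero u → refl ; (suc x) u → hf x u }) hg))))
eval≡evalˢ-toSet (∀₁ φ) n E σ τ f g T hf hg =
  trans (allFin≡not-anyFin-not n _) (cong not (sym
    (trans (anySubset-singleton n _ (evalˢ-extensional (neg (toSet φ _ _)) n E T))
           (anyFin-cong n (λ v → cong not (sym (eval≡evalˢ-toSet φ n E (cons v σ) τ _ _ (cons (singleton v) T)
             (λ { zero u → refl ; (suc x) u → hf x u }) hg)))))))
eval≡evalˢ-toSet (∃₂ φ) n E σ τ f g T hf hg =
  anySubset-cong n (λ Y → eval≡evalˢ-toSet φ n E σ (cons Y τ) _ _ (cons Y T) hf
    (λ { zero u → refl ; (suc X) u → hg X u }))
eval≡evalˢ-toSet (∀₂ φ) n E σ τ f g T hf hg =
  trans (allSubset≡not-anySubset-not n _) (cong not (anySubset-cong n (λ Y → cong not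
    (eval≡evalˢ-toSet φ n E σ (cons Y τ) _ _ (cons Y T) hf (λ { zero u → refl ; (suc X) u → hg X u })))))

noVal : Val 0 n
noVal ()

toSetˢ : ∀ {ρ} → Sentence ρ → SetFormula ρ 0
toSetˢ φ = toSet φ (λ ()) (λ ())

-- The rank-q back-and-forth equivalence of decompositions

meetsColorAt : ∀ {c j} n → (Fin n → Fin c) → Val j n → Fin c → Fin j → Bool
meetsColorAt n col T d X = anyFin n (λ u → T X u ∧ ⌊ col u ≟ᶠ d ⌋)

meetsColorAt-cong : ∀ {c j} n (col : Fin n → Fin c) {T U : Val j n} → T ≋ U →
  ∀ d X → meetsColorAt n col T d X ≡ meetsColorAt n col U d X
meetsColorAt-cong n col h d X = anyFin-cong n (λ u → cong (_∧ ⌊ col u ≟ᶠ d ⌋) (h X u))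

module _ {ρ c : ℕ} where

  -- Besides the atomic formulas of SetFormula, the colors met by each set
  -- variable are recorded: they decide the arcs created by an enclosing join.
  record AtomicEquiv {j} (t : CD ρ c) (T : Val j (size t)) (t' : CD ρ c) (T' : Val j (size t')) : Set where
    field
      subset≡ : ∀ X Y → subsetAt (size t) T X Y ≡ subsetAt (size t') T' X Y
      arc≡    : ∀ a X Y → arcAt (size t) (edge t) T a X Y ≡ arcAt (size t') (edge t') T' a X Y
      size≡   : ∀ X → sizeAt (size t) T X ≡ sizeAt (size t') T' X
      color≡  : ∀ d X → meetsColorAt (size t) (color t) T d X ≡ meetsColorAt (size t') (color t') T' d X
  open AtomicEquiv public

  private variable
    j q : ℕ
    t t' t'' : CD ρ c

  data Equiv : ℕ → ∀ {j} (t : CD ρ c) → Val j (size t) → (t' : CD ρ c) → Val j (size t') → Set where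
    atomic : ∀ {T : Val j (size t)} {T' : Val j (size t')} → AtomicEquiv t T t' T' → Equiv zero t T t' T'
    step   : ∀ {T : Val j (size t)} {T' : Val j (size t')} → Equiv q t T t' T'
           → (∀ Y → ∃ λ Y' → Equiv q t (cons Y T) t' (cons Y' T'))
           → (∀ Y' → ∃ λ Y → Equiv q t (cons Y T) t' (cons Y' T'))
           → Equiv (suc q) t T t' T'

  Equiv-refl : ∀ q t (T : Val j (size t)) → Equiv q t T t T
  Equiv-refl zero    t T = atomic record { subset≡ = λ _ _ → refl ; arc≡ = λ _ _ _ → refl
                                         ; size≡ = λ _ → refl ; color≡ = λ _ _ → refl }
  Equiv-refl (suc q) t T = step (Equiv-refl q t T) (λ Y → Y , Equiv-refl q t _) (λ Y → Y , Equiv-refl q t _)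

  Equiv-sym : ∀ {T : Val j (size t)} {T' : Val j (size t')} → Equiv q t T t' T' → Equiv q t' T' t T
  Equiv-sym (atomic e) = atomic record
    { subset≡ = λ X Y → sym (subset≡ e X Y) ; arc≡ = λ a X Y → sym (arc≡ e a X Y)
    ; size≡ = λ X → sym (size≡ e X) ; color≡ = λ d X → sym (color≡ e d X) }
  Equiv-sym (step e forth back) =
    step (Equiv-sym e) (λ Y → let Y' , h = back Y in Y' , Equiv-sym h)
                       (λ Y → let Y' , h = forth Y in Y' , Equiv-sym h)

  Equiv-trans : ∀ {T : Val j (size t)} {T' : Val j (size t')} {T'' : Val j (size t'')} → Equiv q t T t' T' → Equiv q t' T' t'' T'' → Equiv q t T t'' T''
  Equiv-trans (atomic e) (atomic e') = atomic record
    { subset≡ = λ X Y → trans (subset≡ e X Y) (subset≡ e' X Y)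
    ; arc≡ = λ a X Y → trans (arc≡ e a X Y) (arc≡ e' a X Y)
    ; size≡ = λ X → trans (size≡ e X) (size≡ e' X)
    ; color≡ = λ d X → trans (color≡ e d X) (color≡ e' d X) }
  Equiv-trans (step e forth back) (step e' forth' back') =
    step (Equiv-trans e e')
      (λ Y → let Y' , h = forth Y ; Y'' , h' = forth' Y' in Y'' , Equiv-trans h h')
      (λ Y'' → let Y' , h' = back' Y'' ; Y , h = back Y' in Y , Equiv-trans h h')

  Equiv-congˡ : ∀ {T U : Val j (size t)} {T' : Val j (size t')} → T ≋ U → Equiv q t T t' T' → Equiv q t U t' T'
  Equiv-congˡ {t = t} h (atomic e) = atomic record
    { subset≡ = λ X Y → trans (sym (subsetAt-cong (size t) h X Y)) (subset≡ e X Y)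
    ; arc≡ = λ a X Y → trans (sym (arcAt-cong (size t) (edge t) h a X Y)) (arc≡ e a X Y)
    ; size≡ = λ X → trans (sym (sizeAt-cong (size t) h X)) (size≡ e X)
    ; color≡ = λ d X → trans (sym (meetsColorAt-cong (size t) (color t) h d X)) (color≡ e d X) }
  Equiv-congˡ h (step e forth back) =
    step (Equiv-congˡ h e)
      (λ Y → let Y' , k = forth Y in Y' , Equiv-congˡ (cons-≋ Y h) k)
      (λ Y' → let Y , k = back Y' in Y , Equiv-congˡ (cons-≋ Y h) k)

  Equiv-congʳ : ∀ {T : Val j (size t)} {T' U' : Val j (size t')} → T' ≋ U' → Equiv q t T t' T' → Equiv q t T t' U'
  Equiv-congʳ h e = Equiv-sym (Equiv-congˡ h (Equiv-sym e))

  Equiv⇒AtomicEquiv : ∀ {T : Val j (size t)} {T' : Val j (size t')} → Equiv q t T t' T' → AtomicEquiv t T t' T'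
  Equiv⇒AtomicEquiv (atomic e)   = e
  Equiv⇒AtomicEquiv (step e _ _) = Equiv⇒AtomicEquiv e

  Equiv⇒evalˢ≡ : ∀ {t t'} {T : Val j (size t)} {T' : Val j (size t')} (φ : SetFormula ρ j) → depth φ ≤ q → Equiv q t T t' T' →
    evalˢ φ (size t) (edge t) T ≡ evalˢ φ (size t') (edge t') T'
  Equiv⇒evalˢ≡ (sub X Y)   _ e = subset≡ (Equiv⇒AtomicEquiv e) X Y
  Equiv⇒evalˢ≡ (arc a X Y) _ e = arc≡ (Equiv⇒AtomicEquiv e) a X Y
  Equiv⇒evalˢ≡ (sing X)    _ e = cong isOne (size≡ (Equiv⇒AtomicEquiv e) X)
  Equiv⇒evalˢ≡ (neg φ)     d e = cong not (Equiv⇒evalˢ≡ φ d e)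
  Equiv⇒evalˢ≡ (and φ ψ)   d e =
    cong₂ _∧_ (Equiv⇒evalˢ≡ φ (m⊔n≤o⇒m≤o _ _ d) e) (Equiv⇒evalˢ≡ ψ (m⊔n≤o⇒n≤o _ _ d) e)
  Equiv⇒evalˢ≡ {t = t} {t' = t'} {T = T} {T' = T'} (ex φ) (s≤s d) (step _ forth back) = true⇔⇒≡ to from
    where
    to : _ ≡ true → _ ≡ true
    to h = let Y , hY = anySubset-true⁻ (size t) _ h ; Y' , eY = forth Y in
      anySubset-true (size t') _ (evalˢ-extensional φ (size t') (edge t') T') Y'
        (trans (sym (Equiv⇒evalˢ≡ φ d eY)) hY)
    from : _ ≡ true → _ ≡ true
    from h = let Y' , hY = anySubset-true⁻ (size t') _ h ; Y , eY = back Y' in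
      anySubset-true (size t) _ (evalˢ-extensional φ (size t) (edge t) T) Y
        (trans (Equiv⇒evalˢ≡ φ d eY) hY)

-- Equivalence is a congruence for recolor, join and plugging

data SplitView (m n : ℕ) : Fin (m + n) → Set where
  inˡ : (i : Fin m) → SplitView m n (i ↑ˡ n)
  inʳ : (i : Fin n) → SplitView m n (m ↑ʳ i)

splitView : ∀ m n (u : Fin (m + n)) → SplitView m n u
splitView m n u with splitAt m u in eq
... | inj₁ i = subst (SplitView m n) (splitAt⁻¹-↑ˡ eq) (inˡ i)
... | inj₂ i = subst (SplitView m n) (splitAt⁻¹-↑ʳ eq) (inʳ i)

_++ᵛ_ : ∀ {j} → Val j m → Val j n → Val j (m + n)
_++ᵛ_ {m = m} A B X v = [ A X , B X ]′ (splitAt m v)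

++ᵛ-↑ˡ : ∀ {j} (A : Val j m) (B : Val j n) X i → (A ++ᵛ B) X (i ↑ˡ n) ≡ A X i
++ᵛ-↑ˡ {m} {n} A B X i rewrite splitAt-↑ˡ m i n = refl

++ᵛ-↑ʳ : ∀ {j} (A : Val j m) (B : Val j n) X i → (A ++ᵛ B) X (m ↑ʳ i) ≡ B X i
++ᵛ-↑ʳ {m} {n} A B X i rewrite splitAt-↑ʳ m n i = refl

++ᵛ-split : ∀ m n (Y : Fin (m + n) → Bool) → (λ v → [ Y ∘ (_↑ˡ n) , Y ∘ (m ↑ʳ_) ]′ (splitAt m v)) ≗ Y
++ᵛ-split m n Y v = trans (sym ([,]-∘ Y (splitAt m v))) (cong Y (join-splitAt m n v))

colorLinked : ∀ {c} → (Fin c → Bool) → (Fin c → Bool) → (Fin c → Fin c → Bool) → Bool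
colorLinked {c} hX hY N = anyFin c (λ d → anyFin c (λ d' → hX d ∧ (hY d' ∧ N d d')))

colorLinked-cong : ∀ {c} {hX hX' hY hY' : Fin c → Bool} (N : Fin c → Fin c → Bool) →
  hX ≗ hX' → hY ≗ hY' → colorLinked hX hY N ≡ colorLinked hX' hY' N
colorLinked-cong {c} N e e' = anyFin-cong c (λ d → anyFin-cong c (λ d' → cong₂ (λ a b → a ∧ (b ∧ N d d')) (e d) (e' d')))

-- Arcs added by a join depend only on colors.
anyFin²≡colorLinked : ∀ {c} m n (P : Fin m → Bool) (Q : Fin n → Bool) (f : Fin m → Fin c) (g : Fin n → Fin c)
  (N : Fin c → Fin c → Bool) →
  anyFin m (λ u → anyFin n (λ v → P u ∧ (Q v ∧ N (f u) (g v))))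
  ≡ colorLinked (λ d → anyFin m (λ u → P u ∧ ⌊ f u ≟ᶠ d ⌋)) (λ d → anyFin n (λ v → Q v ∧ ⌊ g v ≟ᶠ d ⌋)) N
anyFin²≡colorLinked {c} m n P Q f g N = true⇔⇒≡ to from
  where
  hX = λ d → anyFin m (λ u → P u ∧ ⌊ f u ≟ᶠ d ⌋)
  hY = λ d → anyFin n (λ v → Q v ∧ ⌊ g v ≟ᶠ d ⌋)
  to : anyFin m (λ u → anyFin n (λ v → P u ∧ (Q v ∧ N (f u) (g v)))) ≡ true → colorLinked hX hY N ≡ true
  to e with anyFin-true⁻ m _ e
  ... | u , h with anyFin-true⁻ n _ h
  ...   | v , h' =
    let Pu = ∧-true⁻ˡ (P u) h'
        Qv = ∧-true⁻ˡ (Q v) (∧-true⁻ʳ (P u) h')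
        Nuv = ∧-true⁻ʳ (Q v) (∧-true⁻ʳ (P u) h')
    in anyFin-true c _ (f u) (anyFin-true c _ (g v)
         (∧-true (anyFin-true m _ u (∧-true Pu (⌊≟⌋-refl (f u))))
                 (∧-true (anyFin-true n _ v (∧-true Qv (⌊≟⌋-refl (g v)))) Nuv)))
  from : colorLinked hX hY N ≡ true → anyFin m (λ u → anyFin n (λ v → P u ∧ (Q v ∧ N (f u) (g v)))) ≡ true
  from e with anyFin-true⁻ c _ e
  ... | d , h with anyFin-true⁻ c _ h
  ...   | d' , h' with anyFin-true⁻ m _ (∧-true⁻ˡ (hX d) h') | anyFin-true⁻ n _ (∧-true⁻ˡ (hY d') (∧-true⁻ʳ (hX d) h'))
  ...     | u , hu | v , hv =
    let Ndd' = ∧-true⁻ʳ (hY d') (∧-true⁻ʳ (hX d) h') in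
    anyFin-true m _ u (anyFin-true n _ v (∧-true (∧-true⁻ˡ (P u) hu) (∧-true (∧-true⁻ˡ (Q v) hv)
      (subst₂ (λ x y → N x y ≡ true) (sym (⌊⌋-sound (∧-true⁻ʳ (P u) hu))) (sym (⌊⌋-sound (∧-true⁻ʳ (Q v) hv))) Ndd'))))

meetsColorAt-recolor : ∀ {c j} n (col : Fin n → Fin c) (f : Fin c → Fin c) (T : Val j n) d X →
  meetsColorAt n (f ∘ col) T d X ≡ anyFin c (λ d' → meetsColorAt n col T d' X ∧ ⌊ f d' ≟ᶠ d ⌋)
meetsColorAt-recolor {c} n col f T d X = true⇔⇒≡ to from
  where
  to : meetsColorAt n (f ∘ col) T d X ≡ true → anyFin c (λ d' → meetsColorAt n col T d' X ∧ ⌊ f d' ≟ᶠ d ⌋) ≡ true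
  to e with anyFin-true⁻ n _ e
  ... | u , h = anyFin-true c _ (col u)
    (∧-true (anyFin-true n _ u (∧-true (∧-true⁻ˡ (T X u) h) (⌊≟⌋-refl (col u)))) (∧-true⁻ʳ (T X u) h))
  from : anyFin c (λ d' → meetsColorAt n col T d' X ∧ ⌊ f d' ≟ᶠ d ⌋) ≡ true → meetsColorAt n (f ∘ col) T d X ≡ true
  from e with anyFin-true⁻ c _ e
  ... | d' , h with anyFin-true⁻ n _ (∧-true⁻ˡ (meetsColorAt n col T d' X) h)
  ...   | u , hu = anyFin-true n _ u (∧-true (∧-true⁻ˡ (T X u) hu)
    (⌊⌋-complete (f (col u) ≟ᶠ d)
      (trans (cong f (⌊⌋-sound (∧-true⁻ʳ (T X u) hu))) (⌊⌋-sound (∧-true⁻ʳ (meetsColorAt n col T d' X) h)))))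

module _ {ρ c : ℕ} (M : Fin ρ → Side → Fin c → Fin c → Bool) (l r : CD ρ c) where

  private
    nₗ = size l
    nᵣ = size r
    lr = join M l r

  color-join-↑ˡ : ∀ i → color lr (i ↑ˡ nᵣ) ≡ color l i
  color-join-↑ˡ i rewrite splitAt-↑ˡ nₗ i nᵣ = refl

  color-join-↑ʳ : ∀ i → color lr (nₗ ↑ʳ i) ≡ color r i
  color-join-↑ʳ i rewrite splitAt-↑ʳ nₗ nᵣ i = refl

  edge-join-ˡˡ : ∀ a i k → edge lr a (i ↑ˡ nᵣ) (k ↑ˡ nᵣ) ≡ edge l a i k
  edge-join-ˡˡ a i k rewrite splitAt-↑ˡ nₗ i nᵣ | splitAt-↑ˡ nₗ k nᵣ = refl

  edge-join-ˡʳ : ∀ a i k → edge lr a (i ↑ˡ nᵣ) (nₗ ↑ʳ k) ≡ M a right (color l i) (color r k)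
  edge-join-ˡʳ a i k rewrite splitAt-↑ˡ nₗ i nᵣ | splitAt-↑ʳ nₗ nᵣ k = refl

  edge-join-ʳˡ : ∀ a i k → edge lr a (nₗ ↑ʳ i) (k ↑ˡ nᵣ) ≡ M a left (color r i) (color l k)
  edge-join-ʳˡ a i k rewrite splitAt-↑ʳ nₗ nᵣ i | splitAt-↑ˡ nₗ k nᵣ = refl

  edge-join-ʳʳ : ∀ a i k → edge lr a (nₗ ↑ʳ i) (nₗ ↑ʳ k) ≡ edge r a i k
  edge-join-ʳʳ a i k rewrite splitAt-↑ʳ nₗ nᵣ i | splitAt-↑ʳ nₗ nᵣ k = refl

  module _ {j} (A : Val j nₗ) (B : Val j nᵣ) where

    subsetAt-join : ∀ X Y → subsetAt (nₗ + nᵣ) (A ++ᵛ B) X Y ≡ subsetAt nₗ A X Y ∧ subsetAt nᵣ B X Y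
    subsetAt-join X Y = trans (allFin-+ nₗ nᵣ _)
      (cong₂ _∧_ (allFin-cong nₗ (λ i → cong₂ (λ a b → not a ∨ b) (++ᵛ-↑ˡ A B X i) (++ᵛ-↑ˡ A B Y i)))
                 (allFin-cong nᵣ (λ i → cong₂ (λ a b → not a ∨ b) (++ᵛ-↑ʳ A B X i) (++ᵛ-↑ʳ A B Y i))))

    sizeAt-join : ∀ X → sizeAt (nₗ + nᵣ) (A ++ᵛ B) X ≡ sizeAt nₗ A X +₃ sizeAt nᵣ B X
    sizeAt-join X = trans
      (cong cap2 (trans (countFin-+ nₗ nᵣ _)
        (cong₂ _+_ (countFin-cong nₗ (++ᵛ-↑ˡ A B X)) (countFin-cong nᵣ (++ᵛ-↑ʳ A B X)))))
      (cap2-+ (countFin nₗ (A X)) (countFin nᵣ (B X)))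

    meetsColorAt-join : ∀ d X →
      meetsColorAt (nₗ + nᵣ) (color lr) (A ++ᵛ B) d X ≡ meetsColorAt nₗ (color l) A d X ∨ meetsColorAt nᵣ (color r) B d X
    meetsColorAt-join d X = trans (anyFin-+ nₗ nᵣ _)
      (cong₂ _∨_ (anyFin-cong nₗ (λ i → cong₂ (λ a b → a ∧ ⌊ b ≟ᶠ d ⌋) (++ᵛ-↑ˡ A B X i) (color-join-↑ˡ i)))
                 (anyFin-cong nᵣ (λ i → cong₂ (λ a b → a ∧ ⌊ b ≟ᶠ d ⌋) (++ᵛ-↑ʳ A B X i) (color-join-↑ʳ i))))

    arcAt-join : ∀ a X Y → arcAt (nₗ + nᵣ) (edge lr) (A ++ᵛ B) a X Y ≡
      (arcAt nₗ (edge l) A a X Y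
         ∨ colorLinked (λ d → meetsColorAt nₗ (color l) A d X) (λ d → meetsColorAt nᵣ (color r) B d Y) (M a right))
      ∨ (colorLinked (λ d → meetsColorAt nᵣ (color r) B d X) (λ d → meetsColorAt nₗ (color l) A d Y) (M a left)
         ∨ arcAt nᵣ (edge r) B a X Y)
    arcAt-join a X Y = trans (anyFin-+ nₗ nᵣ _) (cong₂ _∨_
      (trans (anyFin-cong nₗ (λ i → anyFin-+ nₗ nᵣ _)) (trans (anyFin-∨ nₗ _ _) (cong₂ _∨_ ll lr′)))
      (trans (anyFin-cong nᵣ (λ i → anyFin-+ nₗ nᵣ _)) (trans (anyFin-∨ nᵣ _ _) (cong₂ _∨_ rl rr))))
      where
      T = A ++ᵛ B
      ll = anyFin-cong nₗ (λ i → anyFin-cong nₗ (λ k →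
             ∧-cong₃ (++ᵛ-↑ˡ A B X i) (++ᵛ-↑ˡ A B Y k) (edge-join-ˡˡ a i k)))
      lr′ = trans (anyFin-cong nₗ (λ i → anyFin-cong nᵣ (λ k →
                    ∧-cong₃ (++ᵛ-↑ˡ A B X i) (++ᵛ-↑ʳ A B Y k) (edge-join-ˡʳ a i k))))
                  (anyFin²≡colorLinked nₗ nᵣ (A X) (B Y) (color l) (color r) (M a right))
      rl = trans (anyFin-cong nᵣ (λ i → anyFin-cong nₗ (λ k →
                   ∧-cong₃ (++ᵛ-↑ʳ A B X i) (++ᵛ-↑ˡ A B Y k) (edge-join-ʳˡ a i k))))
                 (anyFin²≡colorLinked nᵣ nₗ (B X) (A Y) (color r) (color l) (M a left))
      rr = anyFin-cong nᵣ (λ i → anyFin-cong nᵣ (λ k →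
             ∧-cong₃ (++ᵛ-↑ʳ A B X i) (++ᵛ-↑ʳ A B Y k) (edge-join-ʳʳ a i k)))

module _ {ρ c : ℕ} where

  recolor-Equiv : ∀ {q j} (f : Fin c → Fin c) {t t' : CD ρ c} {T : Val j (size t)} {T' : Val j (size t')} →
    Equiv q t T t' T' → Equiv q (recolor f t) T (recolor f t') T'
  recolor-Equiv f {t} {t'} {T} {T'} (atomic e) = atomic record
    { subset≡ = subset≡ e ; arc≡ = arc≡ e ; size≡ = size≡ e
    ; color≡ = λ d X → begin
        meetsColorAt (size t) (f ∘ color t) T d X
          ≡⟨ meetsColorAt-recolor (size t) (color t) f T d X ⟩
        anyFin c (λ d' → meetsColorAt (size t) (color t) T d' X ∧ ⌊ f d' ≟ᶠ d ⌋)
          ≡⟨ anyFin-cong c (λ d' → cong (_∧ ⌊ f d' ≟ᶠ d ⌋) (color≡ e d' X)) ⟩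
        anyFin c (λ d' → meetsColorAt (size t') (color t') T' d' X ∧ ⌊ f d' ≟ᶠ d ⌋)
          ≡⟨ meetsColorAt-recolor (size t') (color t') f T' d X ⟨
        meetsColorAt (size t') (f ∘ color t') T' d X ∎ }
    where open ≡-Reasoning
  recolor-Equiv f (step e forth back) =
    step (recolor-Equiv f e)
      (λ Y → let Y' , h = forth Y in Y' , recolor-Equiv f h)
      (λ Y' → let Y , h = back Y' in Y , recolor-Equiv f h)

  join-Equiv : ∀ {q j} M {l l' r r' : CD ρ c}
    {A : Val j (size l)} {A' : Val j (size l')} {B : Val j (size r)} {B' : Val j (size r')} →
    Equiv q l A l' A' → Equiv q r B r' B' → Equiv q (join M l r) (A ++ᵛ B) (join M l' r') (A' ++ᵛ B')
  join-Equiv M {l} {l'} {r} {r'} {A} {A'} {B} {B'} (atomic eˡ) (atomic eʳ) = atomic record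
    { subset≡ = λ X Y → trans (subsetAt-join M l r A B X Y)
        (trans (cong₂ _∧_ (subset≡ eˡ X Y) (subset≡ eʳ X Y)) (sym (subsetAt-join M l' r' A' B' X Y)))
    ; arc≡ = λ a X Y → trans (arcAt-join M l r A B a X Y) (trans
        (cong₂ _∨_
          (cong₂ _∨_ (arc≡ eˡ a X Y) (colorLinked-cong (M a right) (λ d → color≡ eˡ d X) (λ d → color≡ eʳ d Y)))
          (cong₂ _∨_ (colorLinked-cong (M a left) (λ d → color≡ eʳ d X) (λ d → color≡ eˡ d Y)) (arc≡ eʳ a X Y)))
        (sym (arcAt-join M l' r' A' B' a X Y)))
    ; size≡ = λ X → trans (sizeAt-join M l r A B X)
        (trans (cong₂ _+₃_ (size≡ eˡ X) (size≡ eʳ X)) (sym (sizeAt-join M l' r' A' B' X)))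
    ; color≡ = λ d X → trans (meetsColorAt-join M l r A B d X)
        (trans (cong₂ _∨_ (color≡ eˡ d X) (color≡ eʳ d X)) (sym (meetsColorAt-join M l' r' A' B' d X))) }
  join-Equiv M {l} {l'} {r} {r'} {A} {A'} {B} {B'} (step eˡ forthˡ backˡ) (step eʳ forthʳ backʳ) =
    step (join-Equiv M eˡ eʳ) forth back
    where
    -- a set of the join is the union of a set of each side
    forth : ∀ Y → ∃ λ Y' → Equiv _ (join M l r) (cons Y (A ++ᵛ B)) (join M l' r') (cons Y' (A' ++ᵛ B'))
    forth Y =
      let Yˡ' , hˡ = forthˡ (Y ∘ (_↑ˡ size r)) ; Yʳ' , hʳ = forthʳ (Y ∘ (size l ↑ʳ_)) in
      (λ v → [ Yˡ' , Yʳ' ]′ (splitAt (size l') v)) ,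
      Equiv-congʳ (λ { zero v → refl ; (suc X) v → refl })
        (Equiv-congˡ (λ { zero v → ++ᵛ-split (size l) (size r) Y v ; (suc X) v → refl })
          (join-Equiv M hˡ hʳ))
    back : ∀ Y' → ∃ λ Y → Equiv _ (join M l r) (cons Y (A ++ᵛ B)) (join M l' r') (cons Y' (A' ++ᵛ B'))
    back Y' =
      let Yˡ , hˡ = backˡ (Y' ∘ (_↑ˡ size r')) ; Yʳ , hʳ = backʳ (Y' ∘ (size l' ↑ʳ_)) in
      (λ v → [ Yˡ , Yʳ ]′ (splitAt (size l) v)) ,
      Equiv-congʳ (λ { zero v → ++ᵛ-split (size l') (size r') Y' v ; (suc X) v → refl })
        (Equiv-congˡ (λ { zero v → refl ; (suc X) v → refl })
          (join-Equiv M hˡ hʳ))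

  ▹-Equiv : ∀ {q} (s : CD ρ c) {t t' : CD ρ c} → Equiv q t noVal t' noVal → Equiv q (s ▹ t) noVal (s ▹ t') noVal
  ▹-Equiv □              e = e
  ▹-Equiv (constant L a) e = Equiv-refl _ _ _
  ▹-Equiv (recolor f s)  e = recolor-Equiv f (▹-Equiv s e)
  ▹-Equiv (join M l r)   e =
    Equiv-congʳ (λ ()) (Equiv-congˡ (λ ()) (join-Equiv M (▹-Equiv l e) (▹-Equiv r e)))

-- Finitely many equivalence classes

boolToFin : Bool → Fin 2
boolToFin false = zero
boolToFin true  = suc zero

boolToFin-injective : ∀ {a b} → boolToFin a ≡ boolToFin b → a ≡ b
boolToFin-injective {false} {false} _ = refl
boolToFin-injective {true}  {true}  _ = refl

funToFin-cong : ∀ {a b} {f g : Fin a → Fin b} → f ≗ g → funToFin f ≡ funToFin g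
funToFin-cong {zero}  h = refl
funToFin-cong {suc a} h = cong₂ combine (h zero) (funToFin-cong (h ∘ suc))

funToFin-injective : ∀ {a b} (f g : Fin a → Fin b) → funToFin f ≡ funToFin g → f ≗ g
funToFin-injective f g e x =
  trans (sym (finToFun-funToFin f x)) (trans (cong (λ z → finToFun z x) e) (finToFun-funToFin g x))

combine-injective′ : ∀ a {b} {x x' : Fin a} {y y' : Fin b} → combine x y ≡ combine x' y' → x ≡ x' × y ≡ y'
combine-injective′ a = combine-injective _ _ _ _

code : ∀ {a} → (Fin a → Bool) → Fin (2 ^ a)
code p = funToFin (boolToFin ∘ p)

code₂ : ∀ {a b} → (Fin a → Fin b → Bool) → Fin ((2 ^ b) ^ a)
code₂ p = funToFin (code ∘ p)

code₃ : ∀ {a b e} → (Fin a → Fin b → Fin e → Bool) → Fin (((2 ^ e) ^ b) ^ a)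
code₃ p = funToFin (code₂ ∘ p)

code-cong : ∀ {a} {p q : Fin a → Bool} → p ≗ q → code p ≡ code q
code-cong h = funToFin-cong (cong boolToFin ∘ h)

code₂-cong : ∀ {a b} {p q : Fin a → Fin b → Bool} → (∀ x → p x ≗ q x) → code₂ p ≡ code₂ q
code₂-cong h = funToFin-cong (code-cong ∘ h)

code₃-cong : ∀ {a b e} {p q : Fin a → Fin b → Fin e → Bool} → (∀ x y → p x y ≗ q x y) → code₃ p ≡ code₃ q
code₃-cong h = funToFin-cong (code₂-cong ∘ h)

code-injective : ∀ {a} (p q : Fin a → Bool) → code p ≡ code q → p ≗ q
code-injective p q e x = boolToFin-injective (funToFin-injective _ _ e x)

code₂-injective : ∀ {a b} (p q : Fin a → Fin b → Bool) → code₂ p ≡ code₂ q → ∀ x → p x ≗ q x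
code₂-injective p q e x = code-injective (p x) (q x) (funToFin-injective _ _ e x)

code₃-injective : ∀ {a b e} (p q : Fin a → Fin b → Fin e → Bool) → code₃ p ≡ code₃ q → ∀ x y → p x y ≗ q x y
code₃-injective p q e x = code₂-injective (p x) (q x) (funToFin-injective _ _ e x)

-- Colors are read in Fin k, so that the number of types does not depend on c.
meetsColorBelow : ∀ {c j k} n → (Fin n → Fin c) → Val j n → Fin k → Fin j → Bool
meetsColorBelow n col T d X = anyFin n (λ u → T X u ∧ ⌊ toℕ (col u) ≟ⁿ toℕ d ⌋)

meetsColorBelow-cong : ∀ {c j k} n (col : Fin n → Fin c) {T U : Val j n} → T ≋ U →
  ∀ (d : Fin k) X → meetsColorBelow n col T d X ≡ meetsColorBelow n col U d X
meetsColorBelow-cong n col h d X = anyFin-cong n (λ u → cong (_∧ ⌊ toℕ (col u) ≟ⁿ toℕ d ⌋) (h X u))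

numTypes : (ρ k q j : ℕ) → ℕ
numTypes ρ k zero    j = (2 ^ j) ^ j * ((((2 ^ j) ^ j) ^ ρ) * ((3 ^ j) * ((2 ^ j) ^ k)))
numTypes ρ k (suc q) j = numTypes ρ k q j * 2 ^ numTypes ρ k q (suc j)

module Types {ρ c : ℕ} (k : ℕ) where

  ColorsBelow : CD ρ c → Set
  ColorsBelow t = ∀ v → toℕ (color t v) < k

  atomicType : ∀ {j} (t : CD ρ c) → Val j (size t) → Fin (numTypes ρ k zero j)
  atomicType t T =
    combine (code₂ (subsetAt (size t) T))
   (combine (code₃ (arcAt (size t) (edge t) T))
   (combine (funToFin (sizeAt (size t) T))
            (code₂ (meetsColorBelow {k = k} (size t) (color t) T))))

  typeOf : ∀ q {j} (t : CD ρ c) → Val j (size t) → Fin (numTypes ρ k q j)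
  typeOf zero    t T = atomicType t T
  typeOf (suc q) t T =
    combine (typeOf q t T) (code (λ θ → anySubset (size t) (λ Y → ⌊ typeOf q t (cons Y T) ≟ᶠ θ ⌋)))

  typeOf-cong : ∀ q {j} (t : CD ρ c) {T U : Val j (size t)} → T ≋ U → typeOf q t T ≡ typeOf q t U
  typeOf-cong zero t h =
    cong₂ combine (code₂-cong (subsetAt-cong (size t) h))
   (cong₂ combine (code₃-cong (arcAt-cong (size t) (edge t) h))
   (cong₂ combine (funToFin-cong (sizeAt-cong (size t) h))
                  (code₂-cong {a = k} (meetsColorBelow-cong (size t) (color t) h))))
  typeOf-cong (suc q) t h =
    cong₂ combine (typeOf-cong q t h)
      (code-cong (λ θ → anySubset-cong (size t) (λ Y → cong (λ z → ⌊ z ≟ᶠ θ ⌋) (typeOf-cong q t (cons-≋ Y h)))))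

  meetsColorAt≡Below : ∀ {j} (t : CD ρ c) (T : Val j (size t)) d X (d<k : toℕ d < k) →
    meetsColorAt (size t) (color t) T d X ≡ meetsColorBelow (size t) (color t) T (fromℕ< d<k) X
  meetsColorAt≡Below t T d X d<k = anyFin-cong (size t) (λ u → cong (T X u ∧_) (true⇔⇒≡
    (λ h → ⌊⌋-complete (_ ≟ⁿ _) (trans (cong toℕ (⌊⌋-sound h)) (sym (toℕ-fromℕ< d<k))))
    (λ h → ⌊⌋-complete (_ ≟ᶠ _) (toℕ-injective (trans (⌊⌋-sound h) (toℕ-fromℕ< d<k))))))

  meetsColorAt-unused : ∀ {j} (t : CD ρ c) → ColorsBelow t → (T : Val j (size t)) → ∀ d X → ¬ toℕ d < k →
    meetsColorAt (size t) (color t) T d X ≡ false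
  meetsColorAt-unused t below T d X d≮k = anyFin-false (size t) _ λ u →
    trans (cong (T X u ∧_) (⌊⌋-false (color t u ≟ᶠ d) (λ e → d≮k (subst (λ z → toℕ z < k) e (below u)))))
          (∧-zeroʳ (T X u))

  atomicType≡⇒AtomicEquiv : ∀ {j} (t t' : CD ρ c) {T : Val j (size t)} {T' : Val j (size t')} →
    ColorsBelow t → ColorsBelow t' → atomicType t T ≡ atomicType t' T' → AtomicEquiv t T t' T'
  atomicType≡⇒AtomicEquiv {j} t t' {T} {T'} below below' e = record
    { subset≡ = code₂-injective _ _ eS
    ; arc≡ = code₃-injective _ _ eA
    ; size≡ = funToFin-injective _ _ eN
    ; color≡ = color≡′ }
    where
    e₁ = combine-injective′ ((2 ^ j) ^ j) e
    e₂ = combine-injective′ (((2 ^ j) ^ j) ^ ρ) (proj₂ e₁)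
    e₃ = combine-injective′ (3 ^ j) (proj₂ e₂)
    eS = proj₁ e₁
    eA = proj₁ e₂
    eN = proj₁ e₃
    eC = proj₂ e₃
    color≡′ : ∀ d X → meetsColorAt (size t) (color t) T d X ≡ meetsColorAt (size t') (color t') T' d X
    color≡′ d X with toℕ d <? k
    ... | yes d<k = trans (meetsColorAt≡Below t T d X d<k)
                   (trans (code₂-injective _ _ eC (fromℕ< d<k) X) (sym (meetsColorAt≡Below t' T' d X d<k)))
    ... | no d≮k = trans (meetsColorAt-unused t below T d X d≮k) (sym (meetsColorAt-unused t' below' T' d X d≮k))

  typeOf≡⇒Equiv : ∀ q {j} (t t' : CD ρ c) {T : Val j (size t)} {T' : Val j (size t')} →
    ColorsBelow t → ColorsBelow t' → typeOf q t T ≡ typeOf q t' T' → Equiv q t T t' T'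
  typeOf≡⇒Equiv zero t t' below below' e = atomic (atomicType≡⇒AtomicEquiv t t' below below' e)
  typeOf≡⇒Equiv (suc q) t t' {T} {T'} below below' e =
    step (typeOf≡⇒Equiv q t t' below below' (proj₁ (combine-injective′ (numTypes ρ k q _) e))) forth back
    where
    extensionTypes : (u : CD ρ c) → Val _ (size u) → Fin (numTypes ρ k q _) → Bool
    extensionTypes u U θ = anySubset (size u) (λ Y → ⌊ typeOf q u (cons Y U) ≟ᶠ θ ⌋)
    same : extensionTypes t T ≗ extensionTypes t' T'
    same = code-injective _ _ (proj₂ (combine-injective′ (numTypes ρ k q _) e))
    realised : (u : CD ρ c) (U : Val _ (size u)) → ∀ Y → extensionTypes u U (typeOf q u (cons Y U)) ≡ true
    realised u U Y = anySubset-true (size u) _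
      (λ X Z h → cong (λ z → ⌊ z ≟ᶠ typeOf q u (cons Y U) ⌋) (typeOf-cong q u (cons-≗ U h))) Y (⌊≟⌋-refl _)
    forth : ∀ Y → ∃ λ Y' → Equiv q t (cons Y T) t' (cons Y' T')
    forth Y = let Y' , hY' = anySubset-true⁻ (size t') _ (trans (sym (same _)) (realised t T Y)) in
      Y' , typeOf≡⇒Equiv q t t' below below' (sym (⌊⌋-sound hY'))
    back : ∀ Y' → ∃ λ Y → Equiv q t (cons Y T) t' (cons Y' T')
    back Y' = let Y , hY = anySubset-true⁻ (size t) _ (trans (same _) (realised t' T' Y')) in
      Y , typeOf≡⇒Equiv q t t' below below' (⌊⌋-sound hY)

-- Renaming the colors of a decomposition into an initial segment

module ColorRank {ρ c : ℕ} (t : CD ρ c) where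

  used : Fin c → Bool
  used d = anyFin (size t) (λ u → ⌊ color t u ≟ᶠ d ⌋)

  used-color : ∀ u → used (color t u) ≡ true
  used-color u = anyFin-true (size t) _ u (⌊≟⌋-refl _)

  usedBelow : Fin c → Fin c → Bool
  usedBelow d x = used x ∧ ⌊ toℕ x <? toℕ d ⌋

  usedBelow-self : ∀ d → usedBelow d d ≡ false
  usedBelow-self d = trans (cong (used d ∧_) (⌊⌋-false (toℕ d <? toℕ d) (n≮n (toℕ d)))) (∧-zeroʳ (used d))

  rank : Fin c → ℕ
  rank d = countFin c (usedBelow d)

  rank<c : ∀ d → rank d < c
  rank<c d = subst (rank d <_) (countFin-true c)
    (countFin-strict c _ (λ _ → true) (λ _ _ → refl) d refl (usedBelow-self d))

  rank<numColors : ∀ d → used d ≡ true → rank d < numColors t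
  rank<numColors d ud = countFin-strict c _ used (λ x h → ∧-true⁻ˡ (used x) h) d ud (usedBelow-self d)

  rank-mono : ∀ d₁ d₂ → used d₁ ≡ true → toℕ d₁ < toℕ d₂ → rank d₁ < rank d₂
  rank-mono d₁ d₂ u₁ d₁<d₂ = countFin-strict c _ _
    (λ x h → ∧-true (∧-true⁻ˡ (used x) h)
                    (⌊⌋-complete (toℕ x <? toℕ d₂) (<-trans (⌊⌋-sound (∧-true⁻ʳ (used x) h)) d₁<d₂)))
    d₁ (∧-true u₁ (⌊⌋-complete (toℕ d₁ <? toℕ d₂) d₁<d₂)) (usedBelow-self d₁)

  compress : Fin c → Fin c
  compress d = fromℕ< (rank<c d)

  rank-injective : ∀ d₁ d₂ → used d₁ ≡ true → used d₂ ≡ true → rank d₁ ≡ rank d₂ → d₁ ≡ d₂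
  rank-injective d₁ d₂ u₁ u₂ e with <-cmp (toℕ d₁) (toℕ d₂)
  ... | tri< d₁<d₂ _ _ = ⊥-elim (<-irrefl e (rank-mono d₁ d₂ u₁ d₁<d₂))
  ... | tri≈ _ d₁≡d₂ _ = toℕ-injective d₁≡d₂
  ... | tri> _ _ d₂<d₁ = ⊥-elim (<-irrefl (sym e) (rank-mono d₂ d₁ u₂ d₂<d₁))

  compress-injective : ∀ d₁ d₂ → used d₁ ≡ true → used d₂ ≡ true → compress d₁ ≡ compress d₂ → d₁ ≡ d₂
  compress-injective d₁ d₂ u₁ u₂ e = rank-injective d₁ d₂ u₁ u₂
    (trans (sym (toℕ-fromℕ< (rank<c d₁))) (trans (cong toℕ e) (toℕ-fromℕ< (rank<c d₂))))

  decompress : Fin c → Fin c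
  decompress x with any? (λ d → (used d ≟ᵇ true) ×-dec (compress d ≟ᶠ x))
  ... | yes (d , _) = d
  ... | no _        = x

  decompress-compress : ∀ u → decompress (compress (color t u)) ≡ color t u
  decompress-compress u with any? (λ d → (used d ≟ᵇ true) ×-dec (compress d ≟ᶠ compress (color t u)))
  ... | yes (d , ud , e) = compress-injective d (color t u) ud (used-color u) e
  ... | no ∄d            = ⊥-elim (∄d (color t u , used-color u , refl))

  compress-below : ∀ k → numColors t ≤ k → Types.ColorsBelow k (recolor compress t)
  compress-below k colors≤k u =
    subst (_< k) (sym (toℕ-fromℕ< (rank<c (color t u)))) (<-≤-trans (rank<numColors _ (used-color u)) colors≤k)

-- Plugging marked decompositions

module _ {ρ c : ℕ} where

  ▹-assoc : (a b d : CD ρ c) → (a ▹ b) ▹ d ≡ a ▹ (b ▹ d)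
  ▹-assoc □              b d = refl
  ▹-assoc (constant L x) b d = refl
  ▹-assoc (recolor f a)  b d = cong (recolor f) (▹-assoc a b d)
  ▹-assoc (join M l r)   b d = cong₂ (join M) (▹-assoc l b d) (▹-assoc r b d)

  ▹-closed : (a b : CD ρ c) → holes a ≡ 0 → a ▹ b ≡ a
  ▹-closed □              b ()
  ▹-closed (constant L x) b h = refl
  ▹-closed (recolor f a)  b h = cong (recolor f) (▹-closed a b h)
  ▹-closed (join M l r)   b h =
    cong₂ (join M) (▹-closed l b (m+n≡0⇒m≡0 (holes l) h)) (▹-closed r b (m+n≡0⇒n≡0 (holes l) h))

  holes-▹ : (a b : CD ρ c) → holes (a ▹ b) ≡ holes a * holes b
  holes-▹ □              b = sym (+-identityʳ (holes b))
  holes-▹ (constant L x) b = refl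
  holes-▹ (recolor f a)  b = holes-▹ a b
  holes-▹ (join M l r)   b =
    trans (cong₂ _+_ (holes-▹ l b) (holes-▹ r b)) (sym (*-distribʳ-+ (holes b) (holes l) (holes r)))

  holes-▹-marked : (a b : CD ρ c) → holes a ≡ 1 → holes (a ▹ b) ≡ holes b
  holes-▹-marked a b h = trans (holes-▹ a b) (trans (cong (_* holes b) h) (+-identityʳ (holes b)))

  size-▹ : (a b : CD ρ c) → size (a ▹ b) ≡ size a + holes a * size b
  size-▹ □              b = sym (+-identityʳ (size b))
  size-▹ (constant L x) b = sym (+-identityʳ 1)
  size-▹ (recolor f a)  b = size-▹ a b
  size-▹ (join M l r)   b = begin
    size (l ▹ b) + size (r ▹ b)                                   ≡⟨ cong₂ _+_ (size-▹ l b) (size-▹ r b) ⟩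
    (size l + holes l * size b) + (size r + holes r * size b)     ≡⟨ +-interchange (size l) _ (size r) _ ⟩
    (size l + size r) + (holes l * size b + holes r * size b)     ≡⟨ cong (size l + size r +_) (*-distribʳ-+ (size b) (holes l) (holes r)) ⟨
    size l + size r + (holes l + holes r) * size b                ∎
    where open ≡-Reasoning

  size-▹-marked : (a b : CD ρ c) → holes a ≡ 1 → size (a ▹ b) ≡ size a + size b
  size-▹-marked a b h = trans (size-▹ a b) (cong (size a +_) (trans (cong (_* size b) h) (+-identityʳ (size b))))

  iterate : CD ρ c → ℕ → CD ρ c → CD ρ c
  iterate R zero    e = e
  iterate R (suc ℓ) e = R ▹ iterate R ℓ e

  Δ≡▹iterate : (s R e : CD ρ c) → ∀ ℓ → Δ s (replicate ℓ R ++ e ∷ []) ≡ s ▹ iterate R ℓ e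
  Δ≡▹iterate s R e zero    = refl
  Δ≡▹iterate s R e (suc ℓ) = trans (Δ≡▹iterate (s ▹ R) R e ℓ) (▹-assoc s R (iterate R ℓ e))

  iterate-□ : (R : CD ρ c) → ∀ m x → iterate R m □ ▹ x ≡ iterate R m x
  iterate-□ R zero    x = refl
  iterate-□ R (suc m) x = trans (▹-assoc R (iterate R m □) x) (cong (R ▹_) (iterate-□ R m x))

  iterate-+ : (R : CD ρ c) → ∀ a b e → iterate R a (iterate R b e) ≡ iterate R (a + b) e
  iterate-+ R zero    b e = refl
  iterate-+ R (suc a) b e = cong (R ▹_) (iterate-+ R a b e)

  iterate-iterate : (R : CD ρ c) → ∀ m ℓ e → iterate (iterate R m □) ℓ e ≡ iterate R (ℓ * m) e
  iterate-iterate R m zero    e = refl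
  iterate-iterate R m (suc ℓ) e =
    trans (cong (iterate R m □ ▹_) (iterate-iterate R m ℓ e)) (trans (iterate-□ R m _) (iterate-+ R m (ℓ * m) e))

  holes-iterate : (R : CD ρ c) → ∀ ℓ e → holes R ≡ 1 → holes (iterate R ℓ e) ≡ holes e
  holes-iterate R zero    e h = refl
  holes-iterate R (suc ℓ) e h = trans (holes-▹-marked R _ h) (holes-iterate R ℓ e h)

  size-iterate : (R : CD ρ c) → ∀ ℓ e → holes R ≡ 1 → size (iterate R ℓ e) ≡ ℓ * size R + size e
  size-iterate R zero    e h = refl
  size-iterate R (suc ℓ) e h =
    trans (size-▹-marked R _ h) (trans (cong (size R +_) (size-iterate R ℓ e h)) (sym (+-assoc (size R) _ _)))

  numColors≤width : (t : CD ρ c) → numColors t ≤ width t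
  numColors≤width □              = ≤-reflexive (countFin-false c _ (λ _ → refl))
  numColors≤width (constant L x) = ≤-refl
  numColors≤width (recolor f t)  = m≤m⊔n _ _
  numColors≤width (join M l r)   = m≤m⊔n _ _

  width≤colors : (t : CD ρ c) → width t ≤ c
  width≤colors □              = z≤n
  width≤colors (constant L x) = countFin≤ c _
  width≤colors (recolor f t)  = ⊔-lub (countFin≤ c _) (width≤colors t)
  width≤colors (join M l r)   = ⊔-lub (countFin≤ c _) (⊔-lub (width≤colors l) (width≤colors r))

  width≤width-▹ : (a b : CD ρ c) → 1 ≤ holes a → width b ≤ width (a ▹ b)
  width≤width-▹ □              b h = ≤-refl
  width≤width-▹ (recolor f a)  b h = ≤-trans (width≤width-▹ a b h) (m≤n⊔m (numColors (recolor f a ▹ b)) _)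
  width≤width-▹ (join M l r)   b h with holes l ≟ⁿ 0
  ... | yes l0  = ≤-trans (width≤width-▹ r b (subst (1 ≤_) (cong (_+ holes r) l0) h))
                    (≤-trans (m≤n⊔m (width (l ▹ b)) (width (r ▹ b))) (m≤n⊔m (numColors (join M l r ▹ b)) _))
  ... | no l≢0 = ≤-trans (width≤width-▹ l b (n≢0⇒n>0 l≢0))
                    (≤-trans (m≤m⊔n (width (l ▹ b)) (width (r ▹ b))) (m≤n⊔m (numColors (join M l r ▹ b)) _))

-- A large decomposition is a long chain of non-empty marked pieces

module _ {ρ c : ℕ} where

  NonEmptyMarked : CD ρ c → Set
  NonEmptyMarked k = holes k ≡ 1 × 1 ≤ size k

  plugAll : List (CD ρ c) → CD ρ c → CD ρ c
  plugAll []       e = e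
  plugAll (k ∷ ks) e = k ▹ plugAll ks e

  holes-plugAll : ∀ ks (e : CD ρ c) → All NonEmptyMarked ks → holes (plugAll ks e) ≡ holes e
  holes-plugAll []       e []             = refl
  holes-plugAll (k ∷ ks) e ((h , _) ∷ hs) = trans (holes-▹-marked k _ h) (holes-plugAll ks e hs)

  plugAll-take-drop : ∀ a ks (e : CD ρ c) → plugAll ks e ≡ plugAll (take a ks) □ ▹ plugAll (drop a ks) e
  plugAll-take-drop zero    ks       e = refl
  plugAll-take-drop (suc a) []       e = refl
  plugAll-take-drop (suc a) (k ∷ ks) e = trans (cong (k ▹_) (plugAll-take-drop a ks e)) (sym (▹-assoc k _ _))

  nonEmpty-plugAll-take : ∀ a d ks → All NonEmptyMarked ks → a < length ks →
    1 ≤ size (plugAll (take (suc d) (drop a ks)) □)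
  nonEmpty-plugAll-take zero    d (k ∷ ks) ((_ , sk) ∷ _) _ =
    ≤-trans sk (subst (size k ≤_) (sym (size-▹ k _)) (m≤m+n (size k) _))
  nonEmpty-plugAll-take (suc a) d (k ∷ ks) (_ ∷ hs) (s≤s a<) = nonEmpty-plugAll-take a d ks hs a<

  record Chain (m : ℕ) (t : CD ρ c) : Set where
    constructor chain
    field
      pieces      : List (CD ρ c)
      rest        : CD ρ c
      length≡     : length pieces ≡ m
      nonEmpty    : All NonEmptyMarked pieces
      rest-closed : holes rest ≡ 0
      plug≡       : plugAll pieces rest ≡ t

  private variable
    q : ℕ

  -- Extending the outermost piece by a node keeps the chain.
  chain-recolor : ∀ f {t} → Chain (suc q) t → Chain (suc q) (recolor f t)
  chain-recolor f (chain (k ∷ ks) e len ((h , s) ∷ hs) he eq) =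
    chain (recolor f k ∷ ks) e len ((h , s) ∷ hs) he (cong (recolor f) eq)

  chain-joinˡ : ∀ M {l r} → holes r ≡ 0 → Chain (suc q) l → Chain (suc q) (join M l r)
  chain-joinˡ M {r = r} hr (chain (k ∷ ks) e len ((h , s) ∷ hs) he eq) =
    chain (join M k r ∷ ks) e len ((trans (cong (_+ holes r) h) (cong suc hr) , ≤-trans s (m≤m+n _ _)) ∷ hs) he
      (cong₂ (join M) eq (▹-closed r _ hr))

  chain-joinʳ : ∀ M {l r} → holes l ≡ 0 → Chain (suc q) r → Chain (suc q) (join M l r)
  chain-joinʳ M {l = l} hl (chain (k ∷ ks) e len ((h , s) ∷ hs) he eq) =
    chain (join M l k ∷ ks) e len ((trans (cong (holes l +_) h) (cong (_+ 1) hl) , ≤-trans s (m≤n+m _ _)) ∷ hs) he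
      (cong₂ (join M) (▹-closed l _ hl) eq)

  -- A join with one non-empty closed side is a new piece.
  chain-pieceˡ : ∀ M {l r} → holes r ≡ 0 → 1 ≤ size r → Chain q l → Chain (suc q) (join M l r)
  chain-pieceˡ M {r = r} hr sr (chain ks e len hs he eq) =
    chain (join M □ r ∷ ks) e (cong suc len) ((cong suc hr , ≤-trans sr (m≤n+m _ 0)) ∷ hs) he
      (cong₂ (join M) eq (▹-closed r _ hr))

  chain-pieceʳ : ∀ M {l r} → holes l ≡ 0 → 1 ≤ size l → Chain q r → Chain (suc q) (join M l r)
  chain-pieceʳ M {l = l} hl sl (chain ks e len hs he eq) =
    chain (join M l □ ∷ ks) e (cong suc len) ((cong (_+ 1) hl , ≤-trans sl (m≤m+n _ 0)) ∷ hs) he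
      (cong₂ (join M) (▹-closed l _ hl) eq)

  decompose : ∀ m (t : CD ρ c) → holes t ≡ 0 → 2 ^ m ≤ size t → Chain m t
  decompose zero          t              h p = chain [] t refl [] h refl
  decompose (suc m)       □              () p
  decompose (suc m)       (constant L x) h p = ⊥-elim (<⇒≱ (1<2^suc m) p)
    where 1<2^suc : ∀ m → 1 < 2 ^ suc m
          1<2^suc m = +-mono-≤ (m^n>0 2 m) (≤-trans (m^n>0 2 m) (m≤m+n (2 ^ m) 0))
  decompose (suc m)       (recolor f t)  h p = chain-recolor f (decompose (suc m) t h p)
  decompose (suc m)       (join M l r)   h p with m+n≡0⇒m≡0 (holes l) h | m+n≡0⇒n≡0 (holes l) h
  ... | hl | hr with size l ≟ⁿ 0 | size r ≟ⁿ 0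
  ...   | yes l0 | _      = chain-joinʳ M hl (decompose (suc m) r hr (subst (2 ^ suc m ≤_) (cong (_+ size r) l0) p))
  ...   | no _   | yes r0 =
          chain-joinˡ M hr (decompose (suc m) l hl (subst (2 ^ suc m ≤_) (trans (cong (size l +_) r0) (+-identityʳ _)) p))
  ...   | no l≢0 | no r≢0 with 2 ^ m ≤? size l
  ...     | yes big = chain-pieceˡ M hr (n≢0⇒n>0 r≢0) (decompose m l hl big)
  ...     | no small = chain-pieceʳ M hl (n≢0⇒n>0 l≢0) (decompose m r hr (other-half small))
    where
    other-half : ¬ 2 ^ m ≤ size l → 2 ^ m ≤ size r
    other-half small with 2 ^ m ≤? size r
    ... | yes big = big
    ... | no small' = ⊥-elim (<⇒≱ (+-mono-< (≰⇒> small) (≰⇒> small'))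
                                   (subst (_≤ size l + size r) (cong (2 ^ m +_) (+-identityʳ (2 ^ m))) p))

-- Pumping

module _ {ρ c : ℕ} where

  recolor-recolor-Equiv : ∀ q {j} (t : CD ρ c) (g f : Fin c → Fin c) (T : Val j (size t)) →
    (∀ u → g (f (color t u)) ≡ color t u) → Equiv q (recolor g (recolor f t)) T t T
  recolor-recolor-Equiv zero t g f T gf = atomic record
    { subset≡ = λ _ _ → refl ; arc≡ = λ _ _ _ → refl ; size≡ = λ _ → refl
    ; color≡ = λ d X → anyFin-cong (size t) (λ u → cong (λ z → T X u ∧ ⌊ z ≟ᶠ d ⌋) (gf u)) }
  recolor-recolor-Equiv (suc q) t g f T gf =
    step (recolor-recolor-Equiv q t g f T gf)
      (λ Y → Y , recolor-recolor-Equiv q t g f _ gf) (λ Y → Y , recolor-recolor-Equiv q t g f _ gf)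

  iterate-Equiv : ∀ {q} {R e : CD ρ c} → Equiv q (R ▹ e) noVal e noVal → ∀ ℓ → Equiv q (iterate R ℓ e) noVal e noVal
  iterate-Equiv         loop zero    = Equiv-refl _ _ _
  iterate-Equiv {R = R} loop (suc ℓ) = Equiv-trans (▹-Equiv R (iterate-Equiv loop ℓ)) loop

module Pumping {ρ c : ℕ} (k : ℕ) where

  open ColorRank using (compress; decompress)

  normalForm : CD ρ c → CD ρ c
  normalForm t = recolor (compress t) t

  normalType : ∀ q → CD ρ c → Fin (numTypes ρ k q 0)
  normalType q t = Types.typeOf k q (normalForm t) noVal

  recolor-onto : ∀ q (u v : CD ρ c) → numColors u ≤ k → numColors v ≤ k → normalType q u ≡ normalType q v →
    Equiv q (recolor (decompress v) (normalForm u)) noVal v noVal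
  recolor-onto q u v ku kv same = Equiv-trans
    (recolor-Equiv (decompress v)
      (Types.typeOf≡⇒Equiv k q (normalForm u) (normalForm v)
        (ColorRank.compress-below u k ku) (ColorRank.compress-below v k kv) same))
    (recolor-recolor-Equiv q v (decompress v) (compress v) noVal (ColorRank.decompress-compress v))

  record Pump (q : ℕ) (t : CD ρ c) : Set where
    field
      start loop end : CD ρ c
      holes-start    : holes start ≡ 1
      holes-loop     : holes loop ≡ 1
      holes-end      : holes end ≡ 0
      loop-nonEmpty  : 1 ≤ size loop
      sizes≡         : size start + size loop + size end ≡ size t
      pumped         : ∀ ℓ → Equiv q (start ▹ iterate loop ℓ end) noVal t noVal

  pump-loop : ∀ q (s₀ r₀ e : CD ρ c) → holes s₀ ≡ 1 → holes r₀ ≡ 1 → holes e ≡ 0 → 1 ≤ size r₀ →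
    numColors (r₀ ▹ e) ≤ k → numColors e ≤ k → normalType q (r₀ ▹ e) ≡ normalType q e →
    Pump q (s₀ ▹ (r₀ ▹ e))
  pump-loop q s₀ r₀ e hs hr he sr kre ke same = record
    { start = s₀ ▹ W ; loop = R ; end = e
    ; holes-start = holes-▹-marked s₀ W hs
    ; holes-loop = hr ; holes-end = he ; loop-nonEmpty = sr
    ; sizes≡ = sizes
    ; pumped = λ ℓ → subst (λ x → Equiv q x noVal (s₀ ▹ (r₀ ▹ e)) noVal) (sym (▹-assoc s₀ W (iterate R ℓ e)))
                 (▹-Equiv s₀ (Equiv-trans (▹-Equiv W (iterate-Equiv loop ℓ)) back)) }
    where
    -- R renames the colors of r₀ so that R ▹ e behaves like e, and W renames
    -- those of e so that W ▹ e behaves like r₀ ▹ e.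
    R = recolor (decompress e) (recolor (compress (r₀ ▹ e)) r₀)
    W = recolor (decompress (r₀ ▹ e)) (recolor (compress e) □)
    loop : Equiv q (R ▹ e) noVal e noVal
    loop = recolor-onto q (r₀ ▹ e) e kre ke same
    back : Equiv q (W ▹ e) noVal (r₀ ▹ e) noVal
    back = recolor-onto q e (r₀ ▹ e) ke kre (sym same)
    sizes : size (s₀ ▹ W) + size R + size e ≡ size (s₀ ▹ (r₀ ▹ e))
    sizes = begin
      size (s₀ ▹ W) + size r₀ + size e    ≡⟨ cong (λ z → z + size r₀ + size e) (size-▹-marked s₀ W hs) ⟩
      size s₀ + 0 + size r₀ + size e      ≡⟨ cong (λ z → z + size r₀ + size e) (+-identityʳ (size s₀)) ⟩
      size s₀ + size r₀ + size e          ≡⟨ +-assoc (size s₀) _ _ ⟩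
      size s₀ + (size r₀ + size e)        ≡⟨ cong (size s₀ +_) (size-▹-marked r₀ e hr) ⟨
      size s₀ + size (r₀ ▹ e)             ≡⟨ size-▹-marked s₀ (r₀ ▹ e) hs ⟨
      size (s₀ ▹ (r₀ ▹ e))                ∎
      where open ≡-Reasoning

  pump-chain : ∀ q (t : CD ρ c) → width t ≤ k → Chain (numTypes ρ k q 0) t → Pump q t
  pump-chain q t wt (chain ks e len hs he eq)
    with pigeonhole (n<1+n (numTypes ρ k q 0)) (λ i → normalType q (plugAll (drop (toℕ i) ks) e))
  ... | i , j , i<j , same with m≤n⇒∃[o]m+o≡n i<j
  ...   | o , i+o≡j = subst (Pump q) (sym t≡) (pump-loop q s₀ r₀ e' hs₀ hr₀ he' r₀-nonEmpty
                        (subst (λ x → numColors x ≤ k) suffixᵢ≡ (suffix-colors a))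
                        (subst (λ x → numColors x ≤ k) suffixⱼ≡ (suffix-colors (toℕ j)))
                        (subst₂ (λ x y → normalType q x ≡ normalType q y) suffixᵢ≡ suffixⱼ≡ same))
    where
    a = toℕ i
    d = suc o
    suffix : ℕ → CD ρ c
    suffix b = plugAll (drop b ks) e
    prefix : ℕ → CD ρ c
    prefix b = plugAll (take b ks) □
    s₀ = prefix a
    r₀ = plugAll (take d (drop a ks)) □
    e' = plugAll (drop d (drop a ks)) e
    hs₀ : holes s₀ ≡ 1
    hs₀ = holes-plugAll (take a ks) □ (take⁺ a hs)
    hr₀ : holes r₀ ≡ 1
    hr₀ = holes-plugAll (take d (drop a ks)) □ (take⁺ d (drop⁺ a hs))
    he' : holes e' ≡ 0
    he' = trans (holes-plugAll (drop d (drop a ks)) e (drop⁺ d (drop⁺ a hs))) he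
    j≡a+d : toℕ j ≡ a + d
    j≡a+d = trans (sym i+o≡j) (sym (+-suc a o))
    r₀-nonEmpty : 1 ≤ size r₀
    r₀-nonEmpty = nonEmpty-plugAll-take a o ks hs
      (<-≤-trans (m<m+n a z<s) (subst (_≤ length ks) j≡a+d (subst (toℕ j ≤_) (sym len) (≤-pred (toℕ<n j)))))
    suffixᵢ≡ : suffix a ≡ r₀ ▹ e'
    suffixᵢ≡ = plugAll-take-drop d (drop a ks) e
    suffixⱼ≡ : suffix (toℕ j) ≡ e'
    suffixⱼ≡ = trans (cong suffix j≡a+d) (cong (λ z → plugAll z e) (sym (drop-drop a d ks)))
    t≡ : t ≡ s₀ ▹ (r₀ ▹ e')
    t≡ = trans (sym eq) (trans (plugAll-take-drop a ks e) (cong (s₀ ▹_) suffixᵢ≡))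
    suffix-colors : ∀ b → numColors (suffix b) ≤ k
    suffix-colors b = ≤-trans (numColors≤width (suffix b))
      (≤-trans (width≤width-▹ (prefix b) (suffix b) (≤-reflexive (sym (holes-plugAll (take b ks) □ (take⁺ b hs)))))
               (subst (λ z → width z ≤ k) (trans (sym eq) (plugAll-take-drop b ks e)) wt))

  pump : ∀ q (t : CD ρ c) → holes t ≡ 0 → width t ≤ k → 2 ^ numTypes ρ k q 0 ≤ size t → Pump q t
  pump q t h wt big = pump-chain q t wt (decompose (numTypes ρ k q 0) t h big)

Equiv⇒⊨≡ : ∀ {ρ c} (φ : Sentence ρ) {t t' : CD ρ c} → Equiv (depth (toSetˢ φ)) t noVal t' noVal → t ⊨ φ ≡ t' ⊨ φ
Equiv⇒⊨≡ φ {t} {t'} e = begin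
  t ⊨ φ                                         ≡⟨ eval≡evalˢ-toSet φ (size t) (edge t) _ _ _ _ noVal (λ ()) (λ ()) ⟩
  evalˢ (toSetˢ φ) (size t) (edge t) noVal      ≡⟨ Equiv⇒evalˢ≡ (toSetˢ φ) ≤-refl e ⟩
  evalˢ (toSetˢ φ) (size t') (edge t') noVal    ≡⟨ eval≡evalˢ-toSet φ (size t') (edge t') _ _ _ _ noVal (λ ()) (λ ()) ⟨
  t' ⊨ φ                                        ∎
  where open ≡-Reasoning

-- Enlarging the set of colors

eval-cong : ∀ {ρ i j} (φ : Formula ρ i j) n {E E' : Fin ρ → Fin n → Fin n → Bool}
  {σ σ' : Fin i → Fin n} {τ τ' : Fin j → Fin n → Bool} →
  (∀ a u v → E a u v ≡ E' a u v) → (∀ x → σ x ≡ σ' x) → (∀ X v → τ X v ≡ τ' X v) →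
  eval φ n E σ τ ≡ eval φ n E' σ' τ'
eval-cong (x ≐ y)     n hE hσ hτ = cong₂ (λ a b → ⌊ a ≟ᶠ b ⌋) (hσ x) (hσ y)
eval-cong (rel a x y) n {E' = E'} hE hσ hτ = trans (hE a _ _) (cong₂ (E' a) (hσ x) (hσ y))
eval-cong (x ∈̇ X)     n {τ' = τ'} hE hσ hτ = trans (hτ X _) (cong (τ' X) (hσ x))
eval-cong (¬̇ φ)       n hE hσ hτ = cong not (eval-cong φ n hE hσ hτ)
eval-cong (φ ∧̇ ψ)     n hE hσ hτ = cong₂ _∧_ (eval-cong φ n hE hσ hτ) (eval-cong ψ n hE hσ hτ)
eval-cong (φ ∨̇ ψ)     n hE hσ hτ = cong₂ _∨_ (eval-cong φ n hE hσ hτ) (eval-cong ψ n hE hσ hτ)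
eval-cong (∃₁ φ)      n hE hσ hτ =
  anyFin-cong n (λ v → eval-cong φ n hE (λ { zero → refl ; (suc x) → hσ x }) hτ)
eval-cong (∀₁ φ)      n hE hσ hτ =
  allFin-cong n (λ v → eval-cong φ n hE (λ { zero → refl ; (suc x) → hσ x }) hτ)
eval-cong (∃₂ φ)      n hE hσ hτ =
  anySubset-cong n (λ Y → eval-cong φ n hE hσ (λ { zero v → refl ; (suc X) v → hτ X v }))
eval-cong (∀₂ φ)      n hE hσ hτ =
  allSubset-cong n (λ Y → eval-cong φ n hE hσ (λ { zero v → refl ; (suc X) v → hτ X v }))

⊨-transport : ∀ {ρ c c'} (t : CD ρ c) (t' : CD ρ c') (p : size t' ≡ size t) →
  (∀ a u v → edge t' a u v ≡ edge t a (subst Fin p u) (subst Fin p v)) → ∀ φ → t' ⊨ φ ≡ t ⊨ φ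
⊨-transport {ρ} t t' p h φ = go (size t) (size t') p (edge t) (edge t') _ _ _ _ h
  where
  go : ∀ n n' (p : n' ≡ n) (E : Fin ρ → Fin n → Fin n → Bool) (E' : Fin ρ → Fin n' → Fin n' → Bool)
    (σ : Fin 0 → Fin n) (σ' : Fin 0 → Fin n') τ τ' → (∀ a u v → E' a u v ≡ E a (subst Fin p u) (subst Fin p v)) →
    eval φ n' E' σ' τ' ≡ eval φ n E σ τ
  go n .n refl E E' σ σ' τ τ' h = eval-cong φ n h (λ ()) (λ ())

subst-↑ˡ : ∀ {m m' n n'} (pl : m' ≡ m) (pr : n' ≡ n) (i : Fin m') →
  subst Fin (cong₂ _+_ pl pr) (i ↑ˡ n') ≡ subst Fin pl i ↑ˡ n
subst-↑ˡ refl refl i = refl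

subst-↑ʳ : ∀ {m m' n n'} (pl : m' ≡ m) (pr : n' ≡ n) (i : Fin n') →
  subst Fin (cong₂ _+_ pl pr) (m' ↑ʳ i) ≡ m ↑ʳ subst Fin pr i
subst-↑ʳ refl refl i = refl

-- ι embeds the colors, π is its partial inverse.
module Embed {ρ c c' : ℕ} (ι : Fin c → Fin c') (π : Fin c' → Maybe (Fin c)) (πι : ∀ x → π (ι x) ≡ just x) where

  embedRecolor : (Fin c → Fin c) → Fin c' → Fin c'
  embedRecolor f d = maybe (ι ∘ f) d (π d)

  embedJoin : (Fin ρ → Side → Fin c → Fin c → Bool) → Fin ρ → Side → Fin c' → Fin c' → Bool
  embedJoin M a s d d' = maybe (λ x → maybe (M a s x) false (π d')) false (π d)

  embedJoin-ι : ∀ M a s x y → embedJoin M a s (ι x) (ι y) ≡ M a s x y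
  embedJoin-ι M a s x y rewrite πι x | πι y = refl

  embed : CD ρ c → CD ρ c'
  embed □              = □
  embed (constant L a) = constant L (ι a)
  embed (recolor f t)  = recolor (embedRecolor f) (embed t)
  embed (join M l r)   = join (embedJoin M) (embed l) (embed r)

  embed-▹ : (a b : CD ρ c) → embed (a ▹ b) ≡ embed a ▹ embed b
  embed-▹ □              b = refl
  embed-▹ (constant L x) b = refl
  embed-▹ (recolor f a)  b = cong (recolor (embedRecolor f)) (embed-▹ a b)
  embed-▹ (join M l r)   b = cong₂ (join (embedJoin M)) (embed-▹ l b) (embed-▹ r b)

  embed-iterate : (R : CD ρ c) → ∀ ℓ e → embed (iterate R ℓ e) ≡ iterate (embed R) ℓ (embed e)
  embed-iterate R zero    e = refl
  embed-iterate R (suc ℓ) e = trans (embed-▹ R _) (cong (embed R ▹_) (embed-iterate R ℓ e))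

  holes-embed : (t : CD ρ c) → holes (embed t) ≡ holes t
  holes-embed □              = refl
  holes-embed (constant L x) = refl
  holes-embed (recolor f t)  = holes-embed t
  holes-embed (join M l r)   = cong₂ _+_ (holes-embed l) (holes-embed r)

  size-embed : (t : CD ρ c) → size (embed t) ≡ size t
  size-embed □              = refl
  size-embed (constant L x) = refl
  size-embed (recolor f t)  = size-embed t
  size-embed (join M l r)   = cong₂ _+_ (size-embed l) (size-embed r)

  private
    ⇣ : (t : CD ρ c) → Fin (size (embed t)) → Fin (size t)
    ⇣ t = subst Fin (size-embed t)

  color-embed : (t : CD ρ c) → ∀ u → color (embed t) u ≡ ι (color t (⇣ t u))
  color-embed (constant L x) u = refl
  color-embed (recolor f t)  u = trans (cong (embedRecolor f) (color-embed t u)) (cong (maybe (ι ∘ f) _) (πι _))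
  color-embed (join M l r)   u with splitView (size (embed l)) (size (embed r)) u
  ... | inˡ i = trans (color-join-↑ˡ (embedJoin M) (embed l) (embed r) i) (trans (color-embed l i)
        (sym (trans (cong (ι ∘ color (join M l r)) (subst-↑ˡ (size-embed l) (size-embed r) i))
                    (cong ι (color-join-↑ˡ M l r _)))))
  ... | inʳ i = trans (color-join-↑ʳ (embedJoin M) (embed l) (embed r) i) (trans (color-embed r i)
        (sym (trans (cong (ι ∘ color (join M l r)) (subst-↑ʳ (size-embed l) (size-embed r) i))
                    (cong ι (color-join-↑ʳ M l r _)))))

  edge-embed : (t : CD ρ c) → ∀ a u v → edge (embed t) a u v ≡ edge t a (⇣ t u) (⇣ t v)
  edge-embed (constant L x) a zero zero = refl
  edge-embed (recolor f t)  a u v = edge-embed t a u v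
  edge-embed (join M l r)   a u v
    with splitView (size (embed l)) (size (embed r)) u | splitView (size (embed l)) (size (embed r)) v
  ... | inˡ i | inˡ k = trans (edge-join-ˡˡ M' l' r' a i k) (trans (edge-embed l a i k)
        (sym (trans (cong₂ (edge (join M l r) a) (subst-↑ˡ pl pr i) (subst-↑ˡ pl pr k)) (edge-join-ˡˡ M l r a _ _))))
    where M' = embedJoin M ; l' = embed l ; r' = embed r ; pl = size-embed l ; pr = size-embed r
  ... | inˡ i | inʳ k = trans (edge-join-ˡʳ M' l' r' a i k)
        (trans (cong₂ (embedJoin M a right) (color-embed l i) (color-embed r k)) (trans (embedJoin-ι M a right _ _)
        (sym (trans (cong₂ (edge (join M l r) a) (subst-↑ˡ pl pr i) (subst-↑ʳ pl pr k)) (edge-join-ˡʳ M l r a _ _)))))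
    where M' = embedJoin M ; l' = embed l ; r' = embed r ; pl = size-embed l ; pr = size-embed r
  ... | inʳ i | inˡ k = trans (edge-join-ʳˡ M' l' r' a i k)
        (trans (cong₂ (embedJoin M a left) (color-embed r i) (color-embed l k)) (trans (embedJoin-ι M a left _ _)
        (sym (trans (cong₂ (edge (join M l r) a) (subst-↑ʳ pl pr i) (subst-↑ˡ pl pr k)) (edge-join-ʳˡ M l r a _ _)))))
    where M' = embedJoin M ; l' = embed l ; r' = embed r ; pl = size-embed l ; pr = size-embed r
  ... | inʳ i | inʳ k = trans (edge-join-ʳʳ M' l' r' a i k) (trans (edge-embed r a i k)
        (sym (trans (cong₂ (edge (join M l r) a) (subst-↑ʳ pl pr i) (subst-↑ʳ pl pr k)) (edge-join-ʳʳ M l r a _ _))))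
    where M' = embedJoin M ; l' = embed l ; r' = embed r ; pl = size-embed l ; pr = size-embed r

  ⊨-embed : (t : CD ρ c) → ∀ φ → embed t ⊨ φ ≡ t ⊨ φ
  ⊨-embed t = ⊨-transport t (embed t) (size-embed t) (edge-embed t)

record PumpedFamily {ρ} (c : ℕ) (φ : Sentence ρ) (base period : ℕ) : Set where
  field
    s r e      : CD ρ c
    holes-s    : holes s ≡ 1
    holes-r    : holes r ≡ 1
    holes-e    : holes e ≡ 0
    r-nonEmpty : 1 ≤ size r
    sat        : ∀ ℓ → (Δ s (replicate ℓ r ++ e ∷ []) ⊨ φ) ≡ true
    size-Δ     : ∀ ℓ → size (Δ s (replicate ℓ r ++ e ∷ [])) ≡ base + ℓ * period

-- Taking m copies of the loop as the new loop multiplies the period by m.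
pumpedFamily : ∀ {ρ c c' k} (ι : Fin c → Fin c') (π : Fin c' → Maybe (Fin c)) → (∀ x → π (ι x) ≡ just x) →
  (φ : Sentence ρ) {t : CD ρ c} → (t ⊨ φ) ≡ true → (P : Pumping.Pump k (depth (toSetˢ φ)) t) →
  ∀ m → 1 ≤ m → PumpedFamily c' φ (size t) (m * size (Pumping.Pump.loop P))
pumpedFamily {ρ} ι π πι φ {t} sat P m m≥1 = record
  { s = embed (s ▹ R) ; r = embed (iterate R m □) ; e = embed e
  ; holes-s = trans (holes-embed (s ▹ R)) (trans (holes-▹-marked s R hs) hR)
  ; holes-r = trans (holes-embed (iterate R m □)) (holes-iterate R m □ hR)
  ; holes-e = trans (holes-embed e) he
  ; r-nonEmpty = subst (1 ≤_) (sym (trans (size-embed (iterate R m □)) (size-iterate R m □ hR)))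
                   (≤-trans (*-mono-≤ m≥1 sR) (m≤m+n (m * size R) 0))
  ; sat = λ ℓ → begin
      Δ S' (replicate ℓ R' ++ E' ∷ []) ⊨ φ                ≡⟨ cong (_⊨ φ) (Δ≡embed ℓ) ⟩
      embed (s ▹ iterate R (suc (ℓ * m)) e) ⊨ φ           ≡⟨ ⊨-embed (s ▹ iterate R (suc (ℓ * m)) e) φ ⟩
      (s ▹ iterate R (suc (ℓ * m)) e) ⊨ φ                 ≡⟨ Equiv⇒⊨≡ φ (pumped (suc (ℓ * m))) ⟩
      t ⊨ φ                                               ≡⟨ sat ⟩
      true                                                ∎
  ; size-Δ = λ ℓ → begin
      size (Δ S' (replicate ℓ R' ++ E' ∷ []))             ≡⟨ cong size (Δ≡embed ℓ) ⟩
      size (embed (s ▹ iterate R (suc (ℓ * m)) e))        ≡⟨ size-embed (s ▹ iterate R (suc (ℓ * m)) e) ⟩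
      size (s ▹ iterate R (suc (ℓ * m)) e)                ≡⟨ size-▹-marked s _ hs ⟩
      size s + size (iterate R (suc (ℓ * m)) e)           ≡⟨ cong (size s +_) (size-iterate R (suc (ℓ * m)) e hR) ⟩
      size s + (suc (ℓ * m) * size R + size e)            ≡⟨ rearrange (size s) (size R) (size e) ℓ m ⟩
      size s + size R + size e + ℓ * (m * size R)         ≡⟨ cong (_+ ℓ * (m * size R)) sizes≡ ⟩
      size t + ℓ * (m * size R)                           ∎ }
  where
  open Pumping.Pump P renaming (start to s; loop to R; end to e; holes-start to hs; holes-loop to hR;
                                holes-end to he; loop-nonEmpty to sR)
  open Embed {ρ} ι π πι
  open ≡-Reasoning
  S' = embed (s ▹ R)
  R' = embed (iterate R m □)
  E' = embed e
  Δ≡embed : ∀ ℓ → Δ S' (replicate ℓ R' ++ E' ∷ []) ≡ embed (s ▹ iterate R (suc (ℓ * m)) e)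
  Δ≡embed ℓ = begin
    Δ S' (replicate ℓ R' ++ E' ∷ [])                 ≡⟨ Δ≡▹iterate S' R' E' ℓ ⟩
    S' ▹ iterate R' ℓ E'                             ≡⟨ cong (S' ▹_) (embed-iterate (iterate R m □) ℓ e) ⟨
    S' ▹ embed (iterate (iterate R m □) ℓ e)         ≡⟨ embed-▹ (s ▹ R) _ ⟨
    embed ((s ▹ R) ▹ iterate (iterate R m □) ℓ e)    ≡⟨ cong embed (▹-assoc s R _) ⟩
    embed (s ▹ (R ▹ iterate (iterate R m □) ℓ e))    ≡⟨ cong (λ z → embed (s ▹ (R ▹ z))) (iterate-iterate R m ℓ e) ⟩
    embed (s ▹ iterate R (suc (ℓ * m)) e)            ∎
  rearrange : ∀ S b e ℓ m → S + (suc (ℓ * m) * b + e) ≡ S + b + e + ℓ * (m * b)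
  rearrange = solve 5 (λ S b e ℓ m → S :+ ((con 1 :+ ℓ :* m) :* b :+ e) := S :+ b :+ e :+ ℓ :* (m :* b)) refl

familyPair : ∀ {ρ} (φ₊ φ₋ : Sentence ρ) k → (∀ N → ∃ λ n → N ≤ n × CwGraphOfSize k n φ₊ × CwGraphOfSize k n φ₋) →
  ∃ λ c → ∃ λ base → ∃ λ period → PumpedFamily c φ₊ base period × PumpedFamily c φ₋ base period
familyPair {ρ} φ₊ φ₋ k graphs = fromGraphs (graphs (2 ^ B₊ + 2 ^ B₋))
  where
  B₊ = numTypes ρ k (depth (toSetˢ φ₊)) 0
  B₋ = numTypes ρ k (depth (toSetˢ φ₋)) 0
  fromGraphs : (∃ λ n → 2 ^ B₊ + 2 ^ B₋ ≤ n × CwGraphOfSize k n φ₊ × CwGraphOfSize k n φ₋) →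
    ∃ λ c → ∃ λ base → ∃ λ period → PumpedFamily c φ₊ base period × PumpedFamily c φ₋ base period
  fromGraphs (n , N≤n , (c₁ , t₁ , h₁ , w₁ , n₁ , sat₁) , (c₂ , t₂ , h₂ , w₂ , n₂ , sat₂)) =
    c₁ + c₂ , n , size R₂ * size R₁ ,
    subst (λ b → PumpedFamily (c₁ + c₂) φ₊ b (size R₂ * size R₁)) n₁
      (pumpedFamily (_↑ˡ c₂) π₁ π₁-↑ˡ φ₊ sat₁ P₁ (size R₂) (loop-nonEmpty P₂)) ,
    subst₂ (PumpedFamily (c₁ + c₂) φ₋) n₂ (*-comm (size R₁) (size R₂))
      (pumpedFamily (c₁ ↑ʳ_) π₂ π₂-↑ʳ φ₋ sat₂ P₂ (size R₁) (loop-nonEmpty P₁))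
    where
    open Pumping.Pump
    P₁ : Pumping.Pump k (depth (toSetˢ φ₊)) t₁
    P₁ = Pumping.pump k _ t₁ h₁ w₁ (≤-trans (m≤m+n (2 ^ B₊) (2 ^ B₋)) (≤-trans N≤n (≤-reflexive (sym n₁))))
    P₂ : Pumping.Pump k (depth (toSetˢ φ₋)) t₂
    P₂ = Pumping.pump k _ t₂ h₂ w₂ (≤-trans (m≤n+m (2 ^ B₋) (2 ^ B₊)) (≤-trans N≤n (≤-reflexive (sym n₂))))
    R₁ = loop P₁
    R₂ = loop P₂
    π₁ : Fin (c₁ + c₂) → Maybe (Fin c₁)
    π₁ d = [ just , (λ _ → nothing) ]′ (splitAt c₁ d)
    π₂ : Fin (c₁ + c₂) → Maybe (Fin c₂)
    π₂ d = [ (λ _ → nothing) , just ]′ (splitAt c₁ d)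
    π₁-↑ˡ : ∀ x → π₁ (x ↑ˡ c₂) ≡ just x
    π₁-↑ˡ x rewrite splitAt-↑ˡ c₁ x c₂ = refl
    π₂-↑ʳ : ∀ x → π₂ (c₁ ↑ʳ x) ≡ just x
    π₂-↑ʳ x rewrite splitAt-↑ʳ c₁ c₂ x = refl

lemma17 : (ρ : ℕ) (ψ χ : Sentence ρ) → CwNonTrivial ψ χ → CwSizeIndependent ψ χ →
    ∃ λ k → ∃ λ c →
    Σ (CD ρ c) λ s₊ → Σ (CD ρ c) λ r₊ → Σ (CD ρ c) λ e₊ →
    Σ (CD ρ c) λ s₋ → Σ (CD ρ c) λ r₋ → Σ (CD ρ c) λ e₋ →
      (holes s₊ ≡ 1 × holes r₊ ≡ 1 × holes e₊ ≡ 0 ×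
       holes s₋ ≡ 1 × holes r₋ ≡ 1 × holes e₋ ≡ 0) ×
      (width s₊ ≤ k × width r₊ ≤ k × width e₊ ≤ k ×
       width s₋ ≤ k × width r₋ ≤ k × width e₋ ≤ k) ×
      (∀ ℓ →
        (Δ s₊ (replicate ℓ r₊ ++ e₊ ∷ []) ⊨ (ψ ∧̇ χ)) ≡ true ×
        (Δ s₋ (replicate ℓ r₋ ++ e₋ ∷ []) ⊨ ((¬̇ ψ) ∧̇ χ)) ≡ true ×
        size (Δ s₊ (replicate ℓ r₊ ++ e₊ ∷ [])) ≡ size (Δ s₋ (replicate ℓ r₋ ++ e₋ ∷ []))) ×
      (1 ≤ size r₊ × 1 ≤ size r₋)
-- Any width bound is met by the number of colors.
lemma17 ρ ψ χ _ (k , graphs) =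
  let c , _ , _ , F₊ , F₋ = familyPair (ψ ∧̇ χ) ((¬̇ ψ) ∧̇ χ) k graphs in
  c , c , s F₊ , r F₊ , e F₊ , s F₋ , r F₋ , e F₋ ,
  (holes-s F₊ , holes-r F₊ , holes-e F₊ , holes-s F₋ , holes-r F₋ , holes-e F₋) ,
  (width≤colors (s F₊) , width≤colors (r F₊) , width≤colors (e F₊) ,
   width≤colors (s F₋) , width≤colors (r F₋) , width≤colors (e F₋)) ,
  (λ ℓ → sat F₊ ℓ , sat F₋ ℓ , trans (size-Δ F₊ ℓ) (sym (size-Δ F₋ ℓ))) ,
  (r-nonEmpty F₊ , r-nonEmpty F₋)
  where open PumpedFamily
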